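{- Let $n,x,q,k\geq 0$ be integers with $n+x+q\geq 1$. The number of trees $T\in\Gamma_{n,x,q}$ such that $|int(T)|+|lev_Y(T)|=k+x$ equals $$\binom{n}{k}\binom{k+n+x+q-2}{n+q-1}(n+x+q-1)!.$$
   Context: A plane tree is a rooted tree in which the children of every vertex are linearly ordered. A vertex is internal if it has at least one child and is a leaf otherwise. For integers $n,x,q\geq 0$, $\Gamma_{n,x,q}$ denotes the set of pairs consisting of a plane tree $T$ on $n+x+q$ vertices whose vertices are bijectively labeled by $[n+x+q]=\{1,\dots,n+x+q\}$, together with a coloring of leaves, such that: the vertices labeled $1,\dots,q$ are leaves and are uncolored; the vertices labeled $q+1,\dots,q+x$ are internal; every leaf whose label lies in $\{q+x+1,\dots,q+x+n\}$ is colored either $Y$ or $N$. For such $T$, $int(T)$ is the set of internal vertices, $lev_Y(T)$ the set of leaves colored $Y$, and $lev_N(T)$ the set of leaves colored $N$. Binomial coefficients: for complex $a$ and integer $b$, $\binom{a}{b}=a(a-1)\cdots(a-b+1)/b!$ if $b\geq 0$ and $\binom{a}{b}=0$ if $b<0$. -}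

module Defs where

open import Data.Nat as ℕ using (ℕ; zero; suc; _≤ᵇ_; _≡ᵇ_; _!)
open import Data.Nat.Properties using (_!≢0)
open import Data.Integer as ℤ using (ℤ; +_; -[1+_]; _/ℕ_)
open import Data.Bool using (Bool; true; false; _∧_; not; if_then_else_)
open import Data.List using (List; []; _∷_; _++_; length)
open import Data.Bool.ListAction using (all; any)
open import Data.List.Base using (upTo)

falling : ℤ → ℕ → ℤ
falling a zero    = + 1
falling a (suc b) = falling a b ℤ.* (a ℤ.- + b)

binom : ℤ → ℤ → ℤ
binom a (+ b)      = _/ℕ_ (falling a b) (b !) {{b !≢0}}
binom a -[1+ _ ]   = + 0

data Colour : Set where
  colY colN uncol : Colour

isUncol : Colour → Bool
isUncol uncol = true
isUncol _     = false

isY : Colour → Bool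
isY colY = true
isY _    = false

-- Labelled, coloured plane trees: every vertex carries a label (a
-- natural number), a colour, and the ordered list of its children.

data Tree : Set where
  node : ℕ → Colour → List Tree → Tree

isLeafList : List Tree → Bool
isLeafList [] = true
isLeafList (_ ∷ _) = false

mutual
  labels : Tree → List ℕ
  labels (node i c ts) = i ∷ labelsF ts

  labelsF : List Tree → List ℕ
  labelsF [] = []
  labelsF (t ∷ ts) = labels t ++ labelsF ts

mutual
  nInt : Tree → ℕ
  nInt (node i c []) = 0
  nInt (node i c (t ∷ ts)) = suc (nIntF (t ∷ ts))

  nIntF : List Tree → ℕ
  nIntF [] = 0
  nIntF (t ∷ ts) = nInt t ℕ.+ nIntF ts

mutual
  nLevY : Tree → ℕ
  nLevY (node i c []) = if isY c then 1 else 0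
  nLevY (node i c (t ∷ ts)) = nLevYF (t ∷ ts)

  nLevYF : List Tree → ℕ
  nLevYF [] = 0
  nLevYF (t ∷ ts) = nLevY t ℕ.+ nLevYF ts

vertexOK : ℕ → ℕ → ℕ → Colour → Bool → Bool
vertexOK x q i c lf =
  if i ≤ᵇ q then lf ∧ isUncol c
  else if i ≤ᵇ q ℕ.+ x then not lf ∧ isUncol c
  else if lf then not (isUncol c)
  else isUncol c

mutual
  allVerticesOK : ℕ → ℕ → Tree → Bool
  allVerticesOK x q (node i c ts) =
    vertexOK x q i c (isLeafList ts) ∧ allVerticesOKF x q ts

  allVerticesOKF : ℕ → ℕ → List Tree → Bool
  allVerticesOKF x q [] = true
  allVerticesOKF x q (t ∷ ts) = allVerticesOK x q t ∧ allVerticesOKF x q ts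

-- the labels form a bijection onto [N] = {1,…,N}: there are exactly N
-- vertices and every element of {1,…,N} occurs as a label.
isLabelling : ℕ → List ℕ → Bool
isLabelling N ls =
  (length ls ≡ᵇ N) ∧ all (λ j → any (λ l → suc j ≡ᵇ l) ls) (upTo N)

inΓ : ℕ → ℕ → ℕ → Tree → Bool
inΓ n x q t = isLabelling (n ℕ.+ x ℕ.+ q) (labels t) ∧ allVerticesOK x q t

module Submission where

-- A tree of Γ_{n,x,q} on N = n + x + q labels is a labelled plane tree
-- together with the kind of each label: an uncoloured leaf (labels ≤ q), an
-- internal vertex (labels q+1..q+x), or, for the top n labels, an internal
-- vertex or a Y- or N-leaf.  The proof has three parts.
--  1. For any kind assignment κ on [N], the plane trees labelled by [N] that
--     realise κ number L N i, i the number of internal labels (count-Trees).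
--     This is a bijective recursion: prune the largest label when it is a leaf
--     (RemoveTop); a transposition of labels reduces to this case.  Solving
--     the recursion gives L (m+2) i = (m+1)! C(m, i-1) (L-closed-form).
--  2. Recording the kinds of the top n labels as a word w ∈ {I,Y,N}^n splits
--     Γ by words (Decompose); the statistic is x + #(I or Y in w) and κ_w has
--     x + #(I in w) internal labels, so the count is a sum over words (Count).
--  3. A Vandermonde-type identity evaluates that sum (sumWords-wordTerm), and
--     the result is converted to the integer binomials of the statement.

open import Defs
open import Data.Nat using (ℕ; zero; suc; _+_; _*_; _∸_; _≤_; _<_; z≤n; s≤s; _≡ᵇ_; _≤ᵇ_; _!; pred)
open import Data.Nat.Properties
open import Data.Nat.Tactic.RingSolver using (solve-∀)
open import Data.Nat.DivMod using (m*n/n≡m)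
open import Data.Nat.ListAction using (sum)
open import Data.Nat.ListAction.Properties using (sum-++; sum-↭)
open import Data.Bool using (Bool; true; false; T; _∧_; not; if_then_else_)
open import Data.Bool.Properties using (T-∧; T-≡; T-irrelevant; ∧-assoc)
open import Data.Bool.ListAction using (all; any)
open import Data.Empty using (⊥; ⊥-elim)
open import Data.Unit using (tt)
open import Data.Product using (Σ; _×_; _,_; proj₁; proj₂)
open import Data.Sum using (_⊎_; inj₁; inj₂)
open import Data.Fin as Fin using (Fin; toℕ; fromℕ<)
import Data.Fin.Properties as FinP
open import Data.Fin.Properties using (+↔⊎; *↔×)
open import Data.List using (List; []; _∷_; _++_; length; map; upTo; [_])
open import Data.List.Properties using (length-++; map-++; ++-assoc; map-∘; length-map; map-id; ∷-injective)
open import Data.List.Membership.Propositional using (_∈_)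
open import Data.List.Membership.Propositional.Properties
  using (∈-∃++; ∈-upTo⁺; ∈-upTo⁻; ∈-map⁺; ∈-map⁻; ∈-++⁺ˡ; ∈-++⁺ʳ; ∈-++⁻)
open import Data.List.Relation.Unary.Any using (here; there)
open import Data.List.Relation.Unary.Any.Properties using (any⁺; any⁻)
import Data.List.Relation.Unary.All as All
open import Data.List.Relation.Unary.All.Properties using (all⁺; all⁻)
open import Data.List.Membership.Propositional using (find; lose)
open import Data.List.Relation.Binary.Permutation.Propositional as ↭
  using (_↭_; ↭-refl; ↭-sym; ↭-trans; prep; swap)
open import Data.List.Relation.Binary.Permutation.Propositional.Properties
  using (shift; ++⁺ˡ; ++⁺ʳ; drop-∷; map⁺; ∈-resp-↭; ↭-length; ∷↭∷ʳ; ↭-singleton-inv)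
open import Data.Vec using (Vec; []; _∷_; lookup; tabulate)
open import Data.Vec.Properties using (tabulate∘lookup; tabulate-cong; lookup∘tabulate)
open import Function.Bundles using (_↔_; mk↔ₛ′; module Equivalence)
open import Data.Product.Function.Dependent.Propositional using (Σ-↔)
open import Function.Properties.Inverse using (↔-refl; ↔-sym; ↔-trans)
open import Data.Sum.Function.Propositional using (_⊎-↔_)
open import Relation.Binary.PropositionalEquality hiding ([_])
open import Relation.Nullary using (¬_; contradiction)

open Equivalence using (to; from)

-- Every count in this file is an
-- explicit bijection onto some Fin c; the lemmas below assemble such
-- bijections along the standard operations of enumerative combinatorics.

Fin-cast : ∀ {a b} → a ≡ b → Fin a ↔ Fin b
Fin-cast refl = ↔-refl

empty↔ : ∀ {A : Set} → ¬ A → A ↔ Fin 0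
empty↔ ¬a = mk↔ₛ′ (λ a → ⊥-elim (¬a a)) (λ ()) (λ ()) (λ a → ⊥-elim (¬a a))

Σ-const : ∀ {A : Set} {B : A → Set} {a m} → A ↔ Fin a → (∀ x → B x ↔ Fin m) → Σ A B ↔ Fin (a * m)
Σ-const e f = ↔-trans (Σ-↔ e (f _)) (↔-sym *↔×)

sumFin : ∀ {M} → (Fin M → ℕ) → ℕ
sumFin {zero} g = 0
sumFin {suc M} g = g Fin.zero + sumFin (λ p → g (Fin.suc p))

Σ-Fin-suc : ∀ {M} {B : Fin (suc M) → Set} → Σ (Fin (suc M)) B ↔ (B Fin.zero ⊎ Σ (Fin M) (λ p → B (Fin.suc p)))
Σ-Fin-suc {M} {B} = mk↔ₛ′ split join split∘join join∘split
  where
  split : Σ (Fin (suc M)) B → B Fin.zero ⊎ Σ (Fin M) (λ p → B (Fin.suc p))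
  split (Fin.zero , b) = inj₁ b
  split (Fin.suc p , b) = inj₂ (p , b)
  join : B Fin.zero ⊎ Σ (Fin M) (λ p → B (Fin.suc p)) → Σ (Fin (suc M)) B
  join (inj₁ b) = Fin.zero , b
  join (inj₂ (p , b)) = Fin.suc p , b
  split∘join : ∀ y → split (join y) ≡ y
  split∘join (inj₁ b) = refl
  split∘join (inj₂ (p , b)) = refl
  join∘split : ∀ x → join (split x) ≡ x
  join∘split (Fin.zero , b) = refl
  join∘split (Fin.suc p , b) = refl

Σ-Fin↔sum : ∀ {M} {B : Fin M → Set} (g : Fin M → ℕ) → (∀ p → B p ↔ Fin (g p)) → Σ (Fin M) B ↔ Fin (sumFin g)
Σ-Fin↔sum {zero} g e = mk↔ₛ′ (λ { (() , _) }) (λ ()) (λ ()) (λ { (() , _) })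
Σ-Fin↔sum {suc M} g e =
  ↔-trans Σ-Fin-suc (↔-trans (e Fin.zero ⊎-↔ Σ-Fin↔sum (λ p → g (Fin.suc p)) (λ p → e (Fin.suc p))) (↔-sym +↔⊎))

oneTo : ℕ → List ℕ
oneTo zero = []
oneTo (suc N) = 1 ∷ map suc (oneTo N)

oneTo-snoc : ∀ N → oneTo (suc N) ≡ oneTo N ++ [ suc N ]
oneTo-snoc zero = refl
oneTo-snoc (suc N) = cong (1 ∷_) (trans (cong (map suc) (oneTo-snoc N)) (map-++ suc (oneTo N) [ suc N ]))

length-oneTo : ∀ N → length (oneTo N) ≡ N
length-oneTo zero = refl
length-oneTo (suc N) = cong suc (trans (length-map suc (oneTo N)) (length-oneTo N))

oneTo-suc↭ : ∀ N → oneTo (suc N) ↭ suc N ∷ oneTo N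
oneTo-suc↭ N rewrite oneTo-snoc N = ↭-sym (∷↭∷ʳ (suc N) (oneTo N))

∈oneTo⁺ : ∀ {N j} → j < N → suc j ∈ oneTo N
∈oneTo⁺ {suc N} {zero} _ = here refl
∈oneTo⁺ {suc N} {suc j} (s≤s j<N) = there (∈-map⁺ suc (∈oneTo⁺ j<N))

∈oneTo⁻ : ∀ {N l} → l ∈ oneTo N → Σ ℕ (λ j → l ≡ suc j × j < N)
∈oneTo⁻ {suc N} (here refl) = 0 , refl , s≤s z≤n
∈oneTo⁻ {suc N} (there p) with ∈-map⁻ suc p
... | l' , l'∈ , refl with ∈oneTo⁻ {N} l'∈
... | j , refl , j<N = suc j , refl , s≤s j<N

oneTo-+ : ∀ a b → oneTo (a + b) ≡ oneTo a ++ map (a +_) (oneTo b)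
oneTo-+ zero b = sym (map-id (oneTo b))
oneTo-+ (suc a) b = cong (1 ∷_) (trans (cong (map suc) (oneTo-+ a b))
  (trans (map-++ suc (oneTo a) (map (a +_) (oneTo b))) (cong (map suc (oneTo a) ++_) (sym (map-∘ (oneTo b))))))

T-all⁺ : ∀ {A : Set} (p : A → Bool) (xs : List A) → (∀ {x} → x ∈ xs → T (p x)) → T (all p xs)
T-all⁺ p xs h = all⁻ p (All.tabulate h)

T-all⁻ : ∀ {A : Set} (p : A → Bool) (xs : List A) → T (all p xs) → ∀ {x} → x ∈ xs → T (p x)
T-all⁻ p xs h = All.lookup (all⁺ p xs h)

T-any⁺ : ∀ {A : Set} (p : A → Bool) (xs : List A) {x} → x ∈ xs → T (p x) → T (any p xs)
T-any⁺ p xs x∈ px = any⁺ p (lose x∈ px)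

T-any⁻ : ∀ {A : Set} (p : A → Bool) (xs : List A) → T (any p xs) → Σ A (λ x → x ∈ xs × T (p x))
T-any⁻ p xs h = find (any⁻ p xs h)

Covers : ℕ → List ℕ → Set
Covers N ls = ∀ j → j < N → suc j ∈ ls

isLabelling⇒ : ∀ N ls → T (isLabelling N ls) → (length ls ≡ N) × Covers N ls
isLabelling⇒ N ls h with Equivalence.to T-∧ h
... | h1 , h2 = ≡ᵇ⇒≡ _ _ h1 , λ j j<N →
  let (l , l∈ , e) = T-any⁻ (λ l → suc j ≡ᵇ l) ls (T-all⁻ _ (upTo N) h2 (∈-upTo⁺ j<N))
  in subst (_∈ ls) (sym (≡ᵇ⇒≡ _ _ e)) l∈

isLabelling⇐ : ∀ N ls → length ls ≡ N → Covers N ls → T (isLabelling N ls)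
isLabelling⇐ N ls e c = Equivalence.from T-∧ (≡⇒≡ᵇ _ _ e ,
  T-all⁺ _ (upTo N) (λ {j} m → T-any⁺ (λ l → suc j ≡ᵇ l) ls (c j (∈-upTo⁻ m)) (≡⇒≡ᵇ (suc j) (suc j) refl)))

-- A list of length N covering [N] is a permutation of it (pigeonhole).
covers⇒↭ : ∀ N ls → length ls ≡ N → Covers N ls → ls ↭ oneTo N
covers⇒↭ zero [] e c = ↭-refl
covers⇒↭ (suc N) ls e c with ∈-∃++ (c N ≤-refl)
... | a , b , refl = ↭-trans (shift (suc N) a b) (↭-trans (prep (suc N) ih) (↭-sym (oneTo-suc↭ N)))
  where
  len' : length (a ++ b) ≡ N
  len' = suc-injective (begin
      suc (length (a ++ b)) ≡⟨ cong suc (length-++ a) ⟩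
      suc (length a + length b) ≡⟨ sym (+-suc (length a) (length b)) ⟩
      length a + suc (length b) ≡⟨ sym (length-++ a) ⟩
      length (a ++ suc N ∷ b) ≡⟨ e ⟩
      suc N ∎)
    where open ≡-Reasoning
  cov' : Covers N (a ++ b)
  cov' j j<N with ∈-++⁻ a (c j (≤-trans j<N (n≤1+n N)))
  ... | inj₁ m = ∈-++⁺ˡ m
  ... | inj₂ (here eq) = ⊥-elim (<-irrefl (suc-injective eq) j<N)
  ... | inj₂ (there m) = ∈-++⁺ʳ a m
  ih = covers⇒↭ N (a ++ b) len' cov'

isLabelling⇒↭ : ∀ N ls → T (isLabelling N ls) → ls ↭ oneTo N
isLabelling⇒↭ N ls h = let (e , c) = isLabelling⇒ N ls h in covers⇒↭ N ls e c

↭⇒isLabelling : ∀ N ls → ls ↭ oneTo N → T (isLabelling N ls)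
↭⇒isLabelling N ls p = isLabelling⇐ N ls (trans (↭-length p) (length-oneTo N)) (λ j j<N → ∈-resp-↭ (↭-sym p) (∈oneTo⁺ j<N))

∧-l : ∀ {a b} → T (a ∧ b) → T a
∧-l {a} h = proj₁ (to (T-∧ {a}) h)

∧-r : ∀ {a b} → T (a ∧ b) → T b
∧-r {a} h = proj₂ (to (T-∧ {a}) h)

all-++ : ∀ {A : Set} (f : A → Bool) xs ys → all f (xs ++ ys) ≡ (all f xs ∧ all f ys)
all-++ f [] ys = refl
all-++ f (x ∷ xs) ys = trans (cong (f x ∧_) (all-++ f xs ys)) (sym (∧-assoc (f x) (all f xs) (all f ys)))

all++-l : ∀ {A : Set} (f : A → Bool) xs ys → T (all f (xs ++ ys)) → T (all f xs)
all++-l f xs ys h = ∧-l (subst T (all-++ f xs ys) h)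

all++-r : ∀ {A : Set} (f : A → Bool) xs ys → T (all f (xs ++ ys)) → T (all f ys)
all++-r f xs ys h = ∧-r {all f xs} (subst T (all-++ f xs ys) h)

T-not : ∀ {b} → T (not b) → b ≡ false
T-not {false} _ = refl

T-true : ∀ {b} → b ≡ true → T b
T-true refl = tt

≡ᵇ-refl : ∀ n → (n ≡ᵇ n) ≡ true
≡ᵇ-refl n = to T-≡ (≡⇒≡ᵇ n n refl)

≡ᵇ-true : ∀ {a b} → (a ≡ᵇ b) ≡ true → a ≡ b
≡ᵇ-true {a} {b} e = ≡ᵇ⇒≡ a b (T-true e)

≢⇒≡ᵇ : ∀ a b → a ≢ b → (a ≡ᵇ b) ≡ false
≢⇒≡ᵇ a b ne with a ≡ᵇ b in e
... | true = ⊥-elim (ne (≡ᵇ-true e))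
... | false = refl

T×T-irrelevant : ∀ {a b} (x y : T a × T b) → x ≡ y
T×T-irrelevant {a} {b} (x₁ , x₂) (y₁ , y₂) = cong₂ _,_ (T-irrelevant {a} x₁ y₁) (T-irrelevant {b} x₂ y₂)

all-↭ : ∀ {A : Set} (f : A → Bool) {xs ys} → xs ↭ ys → all f xs ≡ all f ys
all-↭ f ↭.refl = refl
all-↭ f (prep x p) = cong (f x ∧_) (all-↭ f p)
all-↭ f (swap {ys = ys} x y p) = trans (cong (λ r → f x ∧ (f y ∧ r)) (all-↭ f p)) (∧-exchange (f x) (f y) (all f ys))
  where
  ∧-exchange : ∀ a b c → a ∧ (b ∧ c) ≡ b ∧ (a ∧ c)
  ∧-exchange true b c = refl
  ∧-exchange false true c = refl
  ∧-exchange false false c = refl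
all-↭ f (↭.trans p q) = trans (all-↭ f p) (all-↭ f q)

split3 : ∀ {A : Set} (f : A → Bool) pre y post → T (all f (pre ++ y ∷ post)) → T (all f pre) × T (f y) × T (all f post)
split3 f pre y post h with subst T (all-++ f pre (y ∷ post)) h
... | h' = ∧-l h' , ∧-l (∧-r {all f pre} h') , ∧-r {f y} (∧-r {all f pre} h')

join3 : ∀ {A : Set} (f : A → Bool) pre y post → T (all f pre) → T (f y) → T (all f post) → T (all f (pre ++ y ∷ post))
join3 f pre y post a b c = subst T (sym (all-++ f pre (y ∷ post)))
  (from (T-∧ {all f pre}) (a , from (T-∧ {f y}) (b , c)))

all-cong : ∀ {A : Set} (f g : A → Bool) xs → (∀ x → x ∈ xs → f x ≡ g x) → all f xs ≡ all g xs
all-cong f g [] h = refl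
all-cong f g (x ∷ xs) h = cong₂ _∧_ (h x (here refl)) (all-cong f g xs (λ y m → h y (there m)))

sum-cong : ∀ {A : Set} (f g : A → ℕ) xs → (∀ x → x ∈ xs → f x ≡ g x) → sum (map f xs) ≡ sum (map g xs)
sum-cong f g [] h = refl
sum-cong f g (x ∷ xs) h = cong₂ _+_ (h x (here refl)) (sum-cong f g xs (λ y m → h y (there m)))

≤ᵇ-true : ∀ {a b} → a ≤ b → (a ≤ᵇ b) ≡ true
≤ᵇ-true h = to T-≡ (≤⇒≤ᵇ h)

≤ᵇ-false : ∀ {a b} → b < a → (a ≤ᵇ b) ≡ false
≤ᵇ-false {a} {b} h with a ≤ᵇ b in e
... | true = ⊥-elim (<-irrefl refl (≤-trans h (≤ᵇ⇒≤ a b (T-true e))))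
... | false = refl

sum-const : ∀ {A : Set} (f : A → ℕ) c (ls : List A) → (∀ l → l ∈ ls → f l ≡ c) → sum (map f ls) ≡ length ls * c
sum-const f c [] h = refl
sum-const f c (l ∷ ls) h = cong₂ _+_ (h l (here refl)) (sum-const f c ls (λ y m → h y (there m)))

-- The kind of a vertex: internal (kI), a leaf coloured Y / N / uncoloured
-- (kY, kN, kU), or an internal vertex carrying a colour (kB).  The last kind
-- never occurs in Γ_{n,x,q}; it is kept so that every vertex has a kind.
data Kind : Set where
  kI kY kN kU kB : Kind

_==K_ : Kind → Kind → Bool
kI ==K kI = true
kY ==K kY = true
kN ==K kN = true
kU ==K kU = true
kB ==K kB = true
_ ==K _ = false

==K⇒≡ : ∀ a b → T (a ==K b) → a ≡ b
==K⇒≡ kI kI _ = refl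
==K⇒≡ kY kY _ = refl
==K⇒≡ kN kN _ = refl
==K⇒≡ kU kU _ = refl
==K⇒≡ kB kB _ = refl

==K-refl : ∀ a → T (a ==K a)
==K-refl kI = _
==K-refl kY = _
==K-refl kN = _
==K-refl kU = _
==K-refl kB = _

leafK : Colour → Kind
leafK colY = kY
leafK colN = kN
leafK uncol = kU

intK : Colour → Kind
intK uncol = kI
intK _ = kB

kindOf : Colour → List Tree → Kind
kindOf c [] = leafK c
kindOf c (_ ∷ _) = intK c

-- A tree is flattened to the list of its (label, kind) pairs in preorder;
-- the statistics nInt, nLevY and the conditions of Γ are all sums or
-- conjunctions over this list.
Vertex : Set
Vertex = ℕ × Kind

mutual
  vertices : Tree → List Vertex
  vertices (node i c ts) = (i , kindOf c ts) ∷ verticesF ts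

  verticesF : List Tree → List Vertex
  verticesF [] = []
  verticesF (t ∷ ts) = vertices t ++ verticesF ts

mutual
  labels-vertices : ∀ t → labels t ≡ map proj₁ (vertices t)
  labels-vertices (node i c ts) = cong (i ∷_) (labelsF-verticesF ts)

  labelsF-verticesF : ∀ ts → labelsF ts ≡ map proj₁ (verticesF ts)
  labelsF-verticesF [] = refl
  labelsF-verticesF (t ∷ ts) = trans (cong₂ _++_ (labels-vertices t) (labelsF-verticesF ts)) (sym (map-++ proj₁ (vertices t) (verticesF ts)))

isInternal : Kind → ℕ
isInternal kI = 1
isInternal kB = 1
isInternal _ = 0

isLeafY : Kind → ℕ
isLeafY kY = 1
isLeafY _ = 0

sumOver : (Vertex → ℕ) → List Vertex → ℕ
sumOver f xs = sum (map f xs)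

sumOver-++ : ∀ f xs ys → sumOver f (xs ++ ys) ≡ sumOver f xs + sumOver f ys
sumOver-++ f xs ys = trans (cong sum (map-++ f xs ys)) (sum-++ (map f xs) (map f ys))

mutual
  nInt-vertices : ∀ t → nInt t ≡ sumOver (λ p → isInternal (proj₂ p)) (vertices t)
  nInt-vertices (node i colY []) = refl
  nInt-vertices (node i colN []) = refl
  nInt-vertices (node i uncol []) = refl
  nInt-vertices (node i colY (t ∷ ts)) = cong suc (nIntF-verticesF (t ∷ ts))
  nInt-vertices (node i colN (t ∷ ts)) = cong suc (nIntF-verticesF (t ∷ ts))
  nInt-vertices (node i uncol (t ∷ ts)) = cong suc (nIntF-verticesF (t ∷ ts))

  nIntF-verticesF : ∀ ts → nIntF ts ≡ sumOver (λ p → isInternal (proj₂ p)) (verticesF ts)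
  nIntF-verticesF [] = refl
  nIntF-verticesF (t ∷ ts) = trans (cong₂ _+_ (nInt-vertices t) (nIntF-verticesF ts)) (sym (sumOver-++ _ (vertices t) (verticesF ts)))

mutual
  nLevY-vertices : ∀ t → nLevY t ≡ sumOver (λ p → isLeafY (proj₂ p)) (vertices t)
  nLevY-vertices (node i colY []) = refl
  nLevY-vertices (node i colN []) = refl
  nLevY-vertices (node i uncol []) = refl
  nLevY-vertices (node i colY (t ∷ ts)) = nLevYF-verticesF (t ∷ ts)
  nLevY-vertices (node i colN (t ∷ ts)) = nLevYF-verticesF (t ∷ ts)
  nLevY-vertices (node i uncol (t ∷ ts)) = nLevYF-verticesF (t ∷ ts)

  nLevYF-verticesF : ∀ ts → nLevYF ts ≡ sumOver (λ p → isLeafY (proj₂ p)) (verticesF ts)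
  nLevYF-verticesF [] = refl
  nLevYF-verticesF (t ∷ ts) = trans (cong₂ _+_ (nLevY-vertices t) (nLevYF-verticesF ts)) (sym (sumOver-++ _ (vertices t) (verticesF ts)))

isUk isIk isIYNk : Kind → Bool
isUk kU = true
isUk _ = false
isIk kI = true
isIk _ = false
isIYNk kI = true
isIYNk kY = true
isIYNk kN = true
isIYNk _ = false

kindAllowed : ℕ → ℕ → Vertex → Bool
kindAllowed x q (i , k) = if i ≤ᵇ q then isUk k else if i ≤ᵇ q + x then isIk k else isIYNk k

vertexOK-kindOf : ∀ x q i c ts → vertexOK x q i c (isLeafList ts) ≡ kindAllowed x q (i , kindOf c ts)
vertexOK-kindOf x q i c ts with i ≤ᵇ q | i ≤ᵇ q + x
vertexOK-kindOf x q i colY [] | true | _ = refl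
vertexOK-kindOf x q i colN [] | true | _ = refl
vertexOK-kindOf x q i uncol [] | true | _ = refl
vertexOK-kindOf x q i colY (_ ∷ _) | true | _ = refl
vertexOK-kindOf x q i colN (_ ∷ _) | true | _ = refl
vertexOK-kindOf x q i uncol (_ ∷ _) | true | _ = refl
vertexOK-kindOf x q i colY [] | false | true = refl
vertexOK-kindOf x q i colN [] | false | true = refl
vertexOK-kindOf x q i uncol [] | false | true = refl
vertexOK-kindOf x q i colY (_ ∷ _) | false | true = refl
vertexOK-kindOf x q i colN (_ ∷ _) | false | true = refl
vertexOK-kindOf x q i uncol (_ ∷ _) | false | true = refl
vertexOK-kindOf x q i colY [] | false | false = refl
vertexOK-kindOf x q i colN [] | false | false = refl
vertexOK-kindOf x q i uncol [] | false | false = refl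
vertexOK-kindOf x q i colY (_ ∷ _) | false | false = refl
vertexOK-kindOf x q i colN (_ ∷ _) | false | false = refl
vertexOK-kindOf x q i uncol (_ ∷ _) | false | false = refl

mutual
  allVerticesOK-vertices : ∀ x q t → allVerticesOK x q t ≡ all (kindAllowed x q) (vertices t)
  allVerticesOK-vertices x q (node i c ts) = cong₂ _∧_ (vertexOK-kindOf x q i c ts) (allVerticesOKF-verticesF x q ts)

  allVerticesOKF-verticesF : ∀ x q ts → allVerticesOKF x q ts ≡ all (kindAllowed x q) (verticesF ts)
  allVerticesOKF-verticesF x q [] = refl
  allVerticesOKF-verticesF x q (t ∷ ts) = trans (cong₂ _∧_ (allVerticesOK-vertices x q t) (allVerticesOKF-verticesF x q ts)) (sym (all-++ _ (vertices t) (verticesF ts)))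

≡⇒T==K : ∀ {a b} → a ≡ b → T (a ==K b)
≡⇒T==K {a} refl = ==K-refl a

leafK-inj : ∀ c d → T (leafK c ==K leafK d) → c ≡ d
leafK-inj colY colY _ = refl
leafK-inj colN colN _ = refl
leafK-inj uncol uncol _ = refl

leafK-refl : ∀ c → (leafK c ==K leafK c) ≡ true
leafK-refl colY = refl
leafK-refl colN = refl
leafK-refl uncol = refl

isInternal-leafK : ∀ c → isInternal (leafK c) ≡ 0
isInternal-leafK colY = refl
isInternal-leafK colN = refl
isInternal-leafK uncol = refl

isInternal-intK : ∀ d → isInternal (intK d) ≡ 1
isInternal-intK colY = refl
isInternal-intK colN = refl
isInternal-intK uncol = refl

intK≢leafK : ∀ d c → intK d ≢ leafK c
intK≢leafK d c e = 1+n≢0 (trans (sym (isInternal-intK d)) (trans (cong isInternal e) (isInternal-leafK c)))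

isUk⇒ : ∀ k → T (isUk k) → k ≡ kU
isUk⇒ kU _ = refl

isIk⇒ : ∀ k → T (isIk k) → k ≡ kI
isIk⇒ kI _ = refl

isIk⇐ : ∀ k → k ≡ kI → T (isIk k)
isIk⇐ kI _ = tt

-- A Slot is a gap among
-- the children of an internal vertex (a vertex with d children has d+1 gaps);
-- a LeafPos is a leaf, below which the new leaf can hang as an only child.
data Slot : Tree → Set
data SlotF : List Tree → Set
data Slot where
  atRoot : ∀ {i c t ts} → Fin (suc (length (t ∷ ts))) → Slot (node i c (t ∷ ts))
  below : ∀ {i c ts} → SlotF ts → Slot (node i c ts)
data SlotF where
  hd : ∀ {t ts} → Slot t → SlotF (t ∷ ts)
  tl : ∀ {t ts} → SlotF ts → SlotF (t ∷ ts)

data LeafPos : Tree → Set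
data LeafPosF : List Tree → Set
data LeafPos where
  leafP : ∀ {i c} → LeafPos (node i c [])
  inP : ∀ {i c ts} → LeafPosF ts → LeafPos (node i c ts)
data LeafPosF where
  hdL : ∀ {t ts} → LeafPos t → LeafPosF (t ∷ ts)
  tlL : ∀ {t ts} → LeafPosF ts → LeafPosF (t ∷ ts)

mutual
  leafLabel : ∀ {t} → LeafPos t → ℕ
  leafLabel (leafP {i}) = i
  leafLabel (inP p) = leafLabelF p

  leafLabelF : ∀ {ts} → LeafPosF ts → ℕ
  leafLabelF (hdL p) = leafLabel p
  leafLabelF (tlL p) = leafLabelF p

mutual
  leafColour : ∀ {t} → LeafPos t → Colour
  leafColour (leafP {c = c}) = c
  leafColour (inP p) = leafColourF p

  leafColourF : ∀ {ts} → LeafPosF ts → Colour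
  leafColourF (hdL p) = leafColour p
  leafColourF (tlL p) = leafColourF p

module Graft (v : ℕ) (cv : Colour) where

  newLeaf : Tree
  newLeaf = node v cv []

  insertAt : (ts : List Tree) → Fin (suc (length ts)) → List Tree
  insertAt ts Fin.zero = newLeaf ∷ ts
  insertAt (t ∷ ts) (Fin.suc k) = t ∷ insertAt ts k

  mutual
    insertLeaf : (t : Tree) → Slot t → Tree
    insertLeaf (node i c ts) (below fp) = node i c (insertLeafF ts fp)
    insertLeaf (node i c (t ∷ ts)) (atRoot k) = node i c (insertAt (t ∷ ts) k)

    insertLeafF : (ts : List Tree) → SlotF ts → List Tree
    insertLeafF (t ∷ ts) (hd p) = insertLeaf t p ∷ ts
    insertLeafF (t ∷ ts) (tl p) = t ∷ insertLeafF ts p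

  mutual
    hangLeaf : (t : Tree) → LeafPos t → Tree
    hangLeaf (node i c ts) (inP p) = node i c (hangLeafF ts p)
    hangLeaf (node i c []) leafP = node i c [ newLeaf ]

    hangLeafF : (ts : List Tree) → LeafPosF ts → List Tree
    hangLeafF (t ∷ ts) (hdL p) = hangLeaf t p ∷ ts
    hangLeafF (t ∷ ts) (tlL p) = t ∷ hangLeafF ts p

  isNew : Vertex → Bool
  isNew (l , k) = (l ≡ᵇ v) ∧ (k ==K leafK cv)

  isNewLeaf : Tree → Bool
  isNewLeaf (node j d ts) = isNew (j , kindOf d ts)

  -- The outcome of pruning: not found, or the pruned tree together with the
  -- position (a slot, or a leaf that lost its only child) where v sat.
  data Removal : Set where
    notFound : Removal
    fromSlot : (t : Tree) → Slot t → Removal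
    fromLeaf : (t : Tree) → LeafPos t → Removal

  data RemovalF : Set where
    notFoundF : RemovalF
    atSlot : (ts : List Tree) → Fin (suc (length ts)) → RemovalF
    inSlotF : (ts : List Tree) → SlotF ts → RemovalF
    inLeafF : (ts : List Tree) → LeafPosF ts → RemovalF

  fromF : ℕ → Colour → RemovalF → Removal
  fromF i c notFoundF = notFound
  fromF i c (atSlot [] k) = fromLeaf (node i c []) leafP
  fromF i c (atSlot (t ∷ ts) k) = fromSlot (node i c (t ∷ ts)) (atRoot k)
  fromF i c (inSlotF ts fp) = fromSlot (node i c ts) (below fp)
  fromF i c (inLeafF ts lp) = fromLeaf (node i c ts) (inP lp)

  consR : Tree → RemovalF → RemovalF
  consR t notFoundF = notFoundF
  consR t (atSlot ts k) = atSlot (t ∷ ts) (Fin.suc k)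
  consR t (inSlotF ts fp) = inSlotF (t ∷ ts) (tl fp)
  consR t (inLeafF ts lp) = inLeafF (t ∷ ts) (tlL lp)

  combine : Tree → List Tree → Bool → Removal → RemovalF → RemovalF
  combine t ts true _ _ = atSlot ts Fin.zero
  combine t ts false (fromSlot t' π) _ = inSlotF (t' ∷ ts) (hd π)
  combine t ts false (fromLeaf t' lp) _ = inLeafF (t' ∷ ts) (hdL lp)
  combine t ts false notFound r = consR t r

  mutual
    prune : Tree → Removal
    prune (node i c ts) = fromF i c (pruneF ts)

    pruneF : List Tree → RemovalF
    pruneF [] = notFoundF
    pruneF (t ∷ ts) = combine t ts (isNewLeaf t) (prune t) (pruneF ts)

  unprune : Tree → Removal → Tree
  unprune t notFound = t
  unprune _ (fromSlot t π) = insertLeaf t π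
  unprune _ (fromLeaf t lp) = hangLeaf t lp

  unpruneF : List Tree → RemovalF → List Tree
  unpruneF ts notFoundF = ts
  unpruneF _ (atSlot ts k) = insertAt ts k
  unpruneF _ (inSlotF ts fp) = insertLeafF ts fp
  unpruneF _ (inLeafF ts lp) = hangLeafF ts lp

  unprune-fromF : ∀ i c ts r → unprune (node i c ts) (fromF i c r) ≡ node i c (unpruneF ts r)
  unprune-fromF i c ts notFoundF = refl
  unprune-fromF i c ts (atSlot [] Fin.zero) = refl
  unprune-fromF i c ts (atSlot (t ∷ ts') k) = refl
  unprune-fromF i c ts (inSlotF ts' fp) = refl
  unprune-fromF i c ts (inLeafF ts' lp) = refl

  isNewLeaf⇒ : ∀ t → T (isNewLeaf t) → t ≡ newLeaf
  isNewLeaf⇒ (node j d []) h with to (T-∧ {j ≡ᵇ v}) h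
  ... | h1 , h2 rewrite ≡ᵇ⇒≡ j v h1 | leafK-inj d cv h2 = refl
  isNewLeaf⇒ (node j d (_ ∷ _)) h = ⊥-elim (intK≢leafK d cv (==K⇒≡ _ _ (proj₂ (to (T-∧ {j ≡ᵇ v}) h))))

  mutual
    unprune-prune : ∀ t → unprune t (prune t) ≡ t
    unprune-prune (node i c ts) = trans (unprune-fromF i c ts (pruneF ts)) (cong (node i c) (unpruneF-pruneF ts))

    unpruneF-pruneF : ∀ ts → unpruneF ts (pruneF ts) ≡ ts
    unpruneF-pruneF [] = refl
    unpruneF-pruneF (t ∷ ts) with isNewLeaf t in e
    ... | true = cong (_∷ ts) (sym (isNewLeaf⇒ t (subst T (sym e) _)))
    ... | false with prune t | unprune-prune t
    ...   | fromSlot t' π | h = cong (_∷ ts) h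
    ...   | fromLeaf t' lp | h = cong (_∷ ts) h
    ...   | notFound | h = helper (pruneF ts) (unpruneF-pruneF ts)
      where
      helper : ∀ r → unpruneF ts r ≡ ts → unpruneF (t ∷ ts) (consR t r) ≡ t ∷ ts
      helper notFoundF e' = refl
      helper (atSlot ts' k) e' = cong (t ∷_) e'
      helper (inSlotF ts' fp) e' = cong (t ∷_) e'
      helper (inLeafF ts' lp) e' = cong (t ∷_) e'

  notNew : Vertex → Bool
  notNew x = not (isNew x)

  isNewLeaf-old : ∀ t → T (all notNew (vertices t)) → isNewLeaf t ≡ false
  isNewLeaf-old (node j d ts) h = T-not (∧-l h)

  mutual
    prune-notFound : ∀ t → T (all notNew (vertices t)) → prune t ≡ notFound
    prune-notFound (node i c ts) h = cong (fromF i c) (pruneF-notFound ts (∧-r {notNew (i , kindOf c ts)} h))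

    pruneF-notFound : ∀ ts → T (all notNew (verticesF ts)) → pruneF ts ≡ notFoundF
    pruneF-notFound [] h = refl
    pruneF-notFound (t ∷ ts) h
      rewrite isNewLeaf-old t (all++-l notNew (vertices t) (verticesF ts) h)
            | prune-notFound t (all++-l notNew (vertices t) (verticesF ts) h)
            | pruneF-notFound ts (all++-r notNew (vertices t) (verticesF ts) h) = refl

  isNewLeaf-newLeaf : isNewLeaf newLeaf ≡ true
  isNewLeaf-newLeaf rewrite ≡ᵇ-refl v | leafK-refl cv = refl

  pruneF-insertAt : ∀ ts k → T (all notNew (verticesF ts)) → pruneF (insertAt ts k) ≡ atSlot ts k
  pruneF-insertAt ts Fin.zero h rewrite isNewLeaf-newLeaf = refl
  pruneF-insertAt (t ∷ ts) (Fin.suc k) h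
    rewrite isNewLeaf-old t (all++-l notNew (vertices t) (verticesF ts) h)
          | prune-notFound t (all++-l notNew (vertices t) (verticesF ts) h)
          | pruneF-insertAt ts k (all++-r notNew (vertices t) (verticesF ts) h) = refl

  isNewLeaf-internal : ∀ i c t ts → isNewLeaf (node i c (t ∷ ts)) ≡ false
  isNewLeaf-internal i c t ts with i ≡ᵇ v
  ... | false = refl
  ... | true with intK c ==K leafK cv in e
  ... | false = refl
  ... | true = ⊥-elim (intK≢leafK c cv (==K⇒≡ _ _ (T-true e)))

  isNewLeaf-insertLeaf : ∀ t π → isNewLeaf (insertLeaf t π) ≡ false
  isNewLeaf-insertLeaf (node i c (t ∷ ts)) (below (hd p)) = isNewLeaf-internal i c (insertLeaf t p) ts
  isNewLeaf-insertLeaf (node i c (t ∷ ts)) (below (tl p)) = isNewLeaf-internal i c t (insertLeafF ts p)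
  isNewLeaf-insertLeaf (node i c (t ∷ ts)) (atRoot Fin.zero) = isNewLeaf-internal i c newLeaf (t ∷ ts)
  isNewLeaf-insertLeaf (node i c (t ∷ ts)) (atRoot (Fin.suc k)) = isNewLeaf-internal i c t (insertAt ts k)

  isNewLeaf-hangLeaf : ∀ t lp → isNewLeaf (hangLeaf t lp) ≡ false
  isNewLeaf-hangLeaf (node i c (t ∷ ts)) (inP (hdL p)) = isNewLeaf-internal i c (hangLeaf t p) ts
  isNewLeaf-hangLeaf (node i c (t ∷ ts)) (inP (tlL p)) = isNewLeaf-internal i c t (hangLeafF ts p)
  isNewLeaf-hangLeaf (node i c []) leafP = isNewLeaf-internal i c newLeaf []

  mutual
    prune-insertLeaf : ∀ t π → T (all notNew (vertices t)) → prune (insertLeaf t π) ≡ fromSlot t π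
    prune-insertLeaf (node i c ts) (below fp) h = cong (fromF i c) (pruneF-insertLeafF ts fp (∧-r {notNew (i , kindOf c ts)} h))
    prune-insertLeaf (node i c (t ∷ ts)) (atRoot k) h = cong (fromF i c) (pruneF-insertAt (t ∷ ts) k (∧-r {notNew (i , kindOf c (t ∷ ts))} h))

    pruneF-insertLeafF : ∀ ts fp → T (all notNew (verticesF ts)) → pruneF (insertLeafF ts fp) ≡ inSlotF ts fp
    pruneF-insertLeafF (t ∷ ts) (hd p) h
      rewrite isNewLeaf-insertLeaf t p | prune-insertLeaf t p (all++-l notNew (vertices t) (verticesF ts) h) = refl
    pruneF-insertLeafF (t ∷ ts) (tl p) h
      rewrite isNewLeaf-old t (all++-l notNew (vertices t) (verticesF ts) h)
            | prune-notFound t (all++-l notNew (vertices t) (verticesF ts) h)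
            | pruneF-insertLeafF ts p (all++-r notNew (vertices t) (verticesF ts) h) = refl

  mutual
    prune-hangLeaf : ∀ t lp → T (all notNew (vertices t)) → prune (hangLeaf t lp) ≡ fromLeaf t lp
    prune-hangLeaf (node i c ts) (inP p) h = cong (fromF i c) (pruneF-hangLeafF ts p (∧-r {notNew (i , kindOf c ts)} h))
    prune-hangLeaf (node i c []) leafP h rewrite isNewLeaf-newLeaf = refl

    pruneF-hangLeafF : ∀ ts lp → T (all notNew (verticesF ts)) → pruneF (hangLeafF ts lp) ≡ inLeafF ts lp
    pruneF-hangLeafF (t ∷ ts) (hdL p) h
      rewrite isNewLeaf-hangLeaf t p | prune-hangLeaf t p (all++-l notNew (vertices t) (verticesF ts) h) = refl
    pruneF-hangLeafF (t ∷ ts) (tlL p) h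
      rewrite isNewLeaf-old t (all++-l notNew (vertices t) (verticesF ts) h)
            | prune-notFound t (all++-l notNew (vertices t) (verticesF ts) h)
            | pruneF-hangLeafF ts p (all++-r notNew (vertices t) (verticesF ts) h) = refl

  kv : Kind
  kv = leafK cv

  verticesF-insertAt : ∀ ts k → verticesF (insertAt ts k) ↭ (v , kv) ∷ verticesF ts
  verticesF-insertAt ts Fin.zero = ↭-refl
  verticesF-insertAt (t ∷ ts) (Fin.suc k) = ↭-trans (++⁺ˡ (vertices t) (verticesF-insertAt ts k)) (shift (v , kv) (vertices t) (verticesF ts))

  vk-insertAt : ∀ c t ts k → kindOf c (insertAt (t ∷ ts) k) ≡ kindOf c (t ∷ ts)
  vk-insertAt c t ts Fin.zero = refl
  vk-insertAt c t ts (Fin.suc k) = refl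

  mutual
    vertices-insertLeaf : ∀ t π → vertices (insertLeaf t π) ↭ (v , kv) ∷ vertices t
    vertices-insertLeaf (node i c (t ∷ ts)) (below (hd p)) =
      ↭-trans (prep (i , intK c) (↭-trans (++⁺ʳ (verticesF ts) (vertices-insertLeaf t p)) ↭-refl)) (swap (i , intK c) (v , kv) ↭-refl)
    vertices-insertLeaf (node i c (t ∷ ts)) (below (tl p)) =
      ↭-trans (prep (i , intK c) (↭-trans (++⁺ˡ (vertices t) (verticesF-insertLeafF ts p)) (shift (v , kv) (vertices t) (verticesF ts)))) (swap (i , intK c) (v , kv) ↭-refl)
    vertices-insertLeaf (node i c (t ∷ ts)) (atRoot k) rewrite vk-insertAt c t ts k =
      ↭-trans (prep (i , intK c) (verticesF-insertAt (t ∷ ts) k)) (swap (i , intK c) (v , kv) ↭-refl)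

    verticesF-insertLeafF : ∀ ts fp → verticesF (insertLeafF ts fp) ↭ (v , kv) ∷ verticesF ts
    verticesF-insertLeafF (t ∷ ts) (hd p) = ++⁺ʳ (verticesF ts) (vertices-insertLeaf t p)
    verticesF-insertLeafF (t ∷ ts) (tl p) = ↭-trans (++⁺ˡ (vertices t) (verticesF-insertLeafF ts p)) (shift (v , kv) (vertices t) (verticesF ts))

  mutual
    vertices-hangLeaf : ∀ t lp → Σ (List Vertex) λ pre → Σ (List Vertex) λ post →
      (vertices t ≡ pre ++ (leafLabel lp , leafK (leafColour lp)) ∷ post) ×
      (vertices (hangLeaf t lp) ≡ pre ++ (leafLabel lp , intK (leafColour lp)) ∷ (v , kv) ∷ post)
    vertices-hangLeaf (node i c (t ∷ ts)) (inP (hdL p)) with verticesF-hangLeafF (t ∷ ts) (hdL p)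
    ... | pre , post , e1 , e2 = (i , intK c) ∷ pre , post , cong ((i , intK c) ∷_) e1 , cong ((i , intK c) ∷_) e2
    vertices-hangLeaf (node i c (t ∷ ts)) (inP (tlL p)) with verticesF-hangLeafF (t ∷ ts) (tlL p)
    ... | pre , post , e1 , e2 = (i , intK c) ∷ pre , post , cong ((i , intK c) ∷_) e1 , cong ((i , intK c) ∷_) e2
    vertices-hangLeaf (node i c []) leafP = [] , [] , refl , refl

    verticesF-hangLeafF : ∀ ts lfp → Σ (List Vertex) λ pre → Σ (List Vertex) λ post →
      (verticesF ts ≡ pre ++ (leafLabelF lfp , leafK (leafColourF lfp)) ∷ post) ×
      (verticesF (hangLeafF ts lfp) ≡ pre ++ (leafLabelF lfp , intK (leafColourF lfp)) ∷ (v , kv) ∷ post)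
    verticesF-hangLeafF (t ∷ ts) (hdL p) with vertices-hangLeaf t p
    ... | pre , post , e1 , e2 = pre , post ++ verticesF ts ,
          trans (cong (_++ verticesF ts) e1) (++-assoc pre _ (verticesF ts)) ,
          trans (cong (_++ verticesF ts) e2) (++-assoc pre _ (verticesF ts))
    verticesF-hangLeafF (t ∷ ts) (tlL p) with verticesF-hangLeafF ts p
    ... | pre , post , e1 , e2 = vertices t ++ pre , post ,
          trans (cong (vertices t ++_) e1) (sym (++-assoc (vertices t) pre _)) ,
          trans (cong (vertices t ++_) e2) (sym (++-assoc (vertices t) pre _))

  children : Tree → List Tree
  children (node _ _ ts) = ts

  fromF-none : ∀ i c r → fromF i c r ≡ notFound → r ≡ notFoundF
  fromF-none i c notFoundF e = refl
  fromF-none i c (atSlot [] k) ()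
  fromF-none i c (atSlot (x ∷ ts) k) ()
  fromF-none i c (inSlotF ts x) ()
  fromF-none i c (inLeafF ts x) ()

  consR-nf : ∀ t r → consR t r ≡ notFoundF → r ≡ notFoundF
  consR-nf t notFoundF e = refl

  mutual
    notFound⇒old : ∀ t → prune t ≡ notFound → T (all notNew (verticesF (children t)))
    notFound⇒old (node i c ts) e = notFoundF⇒old ts (fromF-none i c (pruneF ts) e)

    notFoundF⇒old : ∀ ts → pruneF ts ≡ notFoundF → T (all notNew (verticesF ts))
    notFoundF⇒old [] e = _
    notFoundF⇒old (t ∷ ts) e with isNewLeaf t in e1 | prune t in e2
    ... | true | _ = contradiction e λ ()
    ... | false | fromSlot _ _ = contradiction e λ ()
    ... | false | fromLeaf _ _ = contradiction e λ ()
    ... | false | notFound = subst T (sym (all-++ notNew (vertices t) (verticesF ts)))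
            (from (T-∧ {all notNew (vertices t)}) (root t e1 e2 , notFoundF⇒old ts (consR-nf t (pruneF ts) e)))
      where
      root : ∀ t → isNewLeaf t ≡ false → prune t ≡ notFound → T (all notNew (vertices t))
      root (node j d ts') e1 e2 = from (T-∧ {notNew (j , kindOf d ts')}) (subst (λ b → T (not b)) (sym e1) _ , notFound⇒old (node j d ts') e2)

-- Number of occurrences of p in a list of labels.  Labels of a tree in
-- Trees N κ occur at most once, which is what makes positions of leaves
-- determined by their labels.
ind : ℕ → ℕ → ℕ
ind l p = if l ≡ᵇ p then 1 else 0

occ : ℕ → List ℕ → ℕ
occ p ls = sum (map (λ l → ind l p) ls)

occ-++ : ∀ p xs ys → occ p (xs ++ ys) ≡ occ p xs + occ p ys
occ-++ p xs ys = trans (cong sum (map-++ _ xs ys)) (sum-++ (map _ xs) _)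

occ-↭ : ∀ p {xs ys} → xs ↭ ys → occ p xs ≡ occ p ys
occ-↭ p xs↭ys = sum-↭ (map⁺ _ xs↭ys)

occ-suc : ∀ p ls → occ (suc p) (map suc ls) ≡ occ p ls
occ-suc p [] = refl
occ-suc p (l ∷ ls) = cong (ind l p +_) (occ-suc p ls)

occ-0 : ∀ ls → occ 0 (map suc ls) ≡ 0
occ-0 [] = refl
occ-0 (l ∷ ls) = occ-0 ls

occ-0-oneTo : ∀ N → occ 0 (oneTo N) ≡ 0
occ-0-oneTo zero = refl
occ-0-oneTo (suc N) = occ-0 (oneTo N)

occ-oneTo : ∀ N p → occ p (oneTo N) ≤ 1
occ-oneTo zero p = z≤n
occ-oneTo (suc N) zero rewrite occ-0 (oneTo N) = z≤n
occ-oneTo (suc N) (suc zero) rewrite occ-suc 0 (oneTo N) | occ-0-oneTo N = s≤s z≤n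
occ-oneTo (suc N) (suc (suc p)) rewrite occ-suc (suc p) (oneTo N) = occ-oneTo N (suc p)

occ-∈ : ∀ p ls → p ∈ ls → 1 ≤ occ p ls
occ-∈ p (l ∷ ls) (here refl) rewrite ≡ᵇ-refl p = s≤s z≤n
occ-∈ p (l ∷ ls) (there m) = ≤-trans (occ-∈ p ls m) (m≤n+m _ (ind l p))

occ-∉ : ∀ p ls → occ p ls ≡ 0 → ∀ {l} → l ∈ ls → l ≢ p
occ-∉ p ls e m refl with occ-∈ _ ls m
... | h rewrite e with h
... | ()

mutual
  leafLabel∈ : ∀ t (lp : LeafPos t) → leafLabel lp ∈ labels t
  leafLabel∈ (node i c ts) (inP p) = there (leafLabelF∈ ts p)
  leafLabel∈ (node i c []) leafP = here refl

  leafLabelF∈ : ∀ ts (lp : LeafPosF ts) → leafLabelF lp ∈ labelsF ts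
  leafLabelF∈ (t ∷ ts) (hdL p) = ∈-++⁺ˡ (leafLabel∈ t p)
  leafLabelF∈ (t ∷ ts) (tlL p) = ∈-++⁺ʳ (labels t) (leafLabelF∈ ts p)

mutual
  leafPos-unique : ∀ t (a b : LeafPos t) → leafLabel a ≡ leafLabel b → occ (leafLabel a) (labels t) ≤ 1 → a ≡ b
  leafPos-unique (node i c []) leafP leafP e h = refl
  leafPos-unique (node i c ts) (inP a) (inP b) e h =
    cong inP (leafPosF-unique ts a b e (≤-trans (m≤n+m _ (ind i (leafLabelF a))) h))

  leafPosF-unique : ∀ ts (a b : LeafPosF ts) → leafLabelF a ≡ leafLabelF b → occ (leafLabelF a) (labelsF ts) ≤ 1 → a ≡ b
  leafPosF-unique (t ∷ ts) (hdL a) (hdL b) e h =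
    cong hdL (leafPos-unique t a b e (≤-trans (m≤m+n _ _) (≤-trans (≤-reflexive (sym (occ-++ (leafLabel a) (labels t) (labelsF ts)))) h)))
  leafPosF-unique (t ∷ ts) (tlL a) (tlL b) e h =
    cong tlL (leafPosF-unique ts a b e (≤-trans (m≤n+m _ _) (≤-trans (≤-reflexive (sym (occ-++ (leafLabelF a) (labels t) (labelsF ts)))) h)))
  leafPosF-unique (t ∷ ts) (hdL a) (tlL b) e h = ⊥-elim (occ-≥2 (leafLabel a) (labels t) (labelsF ts) (leafLabel∈ t a) (subst (_∈ labelsF ts) (sym e) (leafLabelF∈ ts b)) h)
  leafPosF-unique (t ∷ ts) (tlL a) (hdL b) e h = ⊥-elim (occ-≥2 (leafLabelF a) (labels t) (labelsF ts) (subst (_∈ labels t) (sym e) (leafLabel∈ t b)) (leafLabelF∈ ts a) h)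

  occ-≥2 : ∀ p xs ys → p ∈ xs → p ∈ ys → occ p (xs ++ ys) ≤ 1 → ⊥
  occ-≥2 p xs ys m1 m2 h rewrite occ-++ p xs ys with occ-∈ p xs m1 | occ-∈ p ys m2
  ... | a | b = <-irrefl refl (≤-trans (+-mono-≤ a b) h)

agrees : (ℕ → Kind) → Vertex → Bool
agrees κ (l , k) = κ l ==K k

realises : (ℕ → Kind) → Tree → Bool
realises κ t = all (agrees κ) (vertices t)

realisesF : (ℕ → Kind) → List Tree → Bool
realisesF κ ts = all (agrees κ) (verticesF ts)

realises-root : ∀ κ i c ts → T (realises κ (node i c ts)) → T (κ i ==K kindOf c ts)
realises-root κ i c ts h = ∧-l h

realises-children : ∀ κ i c ts → T (realises κ (node i c ts)) → T (realisesF κ ts)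
realises-children κ i c ts h = ∧-r {κ i ==K kindOf c ts} h

realisesF-head : ∀ κ t ts → T (realisesF κ (t ∷ ts)) → T (realises κ t)
realisesF-head κ t ts h = ∧-l (subst T (all-++ _ (vertices t) (verticesF ts)) h)

realisesF-tail : ∀ κ t ts → T (realisesF κ (t ∷ ts)) → T (realisesF κ ts)
realisesF-tail κ t ts h = ∧-r {realises κ t} (subst T (all-++ _ (vertices t) (verticesF ts)) h)

kU-leaf : ∀ c ts → T (kU ==K kindOf c ts) → ts ≡ []
kU-leaf c [] h = refl
kU-leaf colY (x ∷ ts) ()
kU-leaf colN (x ∷ ts) ()
kU-leaf uncol (x ∷ ts) ()

mutual
  findLeaf : ∀ κ p t → T (realises κ t) → κ p ≡ kU → p ∈ labels t → Σ (LeafPos t) (λ lp → leafLabel lp ≡ p)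
  findLeaf κ p (node i c ts) h e (here refl) with kU-leaf c ts (subst (λ k → T (k ==K kindOf c ts)) e (realises-root κ i c ts h))
  ... | refl = leafP , refl
  findLeaf κ p (node i c ts) h e (there m) with findLeafF κ p ts (realises-children κ i c ts h) e m
  ... | lp , e' = inP lp , e'

  findLeafF : ∀ κ p ts → T (realisesF κ ts) → κ p ≡ kU → p ∈ labelsF ts → Σ (LeafPosF ts) (λ lp → leafLabelF lp ≡ p)
  findLeafF κ p (t ∷ ts) h e m with ∈-++⁻ (labels t) m
  ... | inj₁ m1 = let (lp , e') = findLeaf κ p t (realisesF-head κ t ts h) e m1 in hdL lp , e'
  ... | inj₂ m2 = let (lp , e') = findLeafF κ p ts (realisesF-tail κ t ts h) e m2 in tlL lp , e'

update : (ℕ → Kind) → ℕ → Kind → (ℕ → Kind)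
update κ p k l = if l ≡ᵇ p then k else κ l

NoColouredInternal : (ℕ → Kind) → Set
NoColouredInternal κ = ∀ l → κ l ≡ kB → ⊥

Labelled : ℕ → Tree → Set
Labelled N t = T (isLabelling N (labels t))

Trees : ℕ → (ℕ → Kind) → Set
Trees N κ = Σ Tree (λ t → Labelled N t × T (realises κ t))

-- Membership proofs are Boolean, so an element of Trees N κ is its tree.
Trees-≡ : ∀ {N κ} (x y : Trees N κ) → proj₁ x ≡ proj₁ y → x ≡ y
Trees-≡ (t , p) (.t , q) refl = cong (t ,_) (T×T-irrelevant p q)

countInternal : (ℕ → Kind) → List ℕ → ℕ
countInternal κ ls = sum (map (λ l → isInternal (κ l)) ls)

nInternal : ℕ → (ℕ → Kind) → ℕ
nInternal N κ = countInternal κ (oneTo N)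

-- The number of trees on [N] with a prescribed set of i internal labels.  The
-- recursion records where a leaf labelled M+2 sits: in one of the M+i slots of
-- a tree on [M+1], or as the only child of one of the i internal labels,
-- which was a leaf before.
L : ℕ → ℕ → ℕ
L zero _ = 0
L (suc zero) zero = 1
L (suc zero) (suc _) = 0
L (suc (suc M)) i = L (suc M) i * (M + i) + i * L (suc M) (pred i)

update-other : ∀ κ p k l → l ≢ p → update κ p k l ≡ κ l
update-other κ p k l ne with l ≡ᵇ p in e
... | true = ⊥-elim (ne (≡ᵇ-true e))
... | false = refl

update-same : ∀ κ p k → update κ p k p ≡ k
update-same κ p k rewrite ≡ᵇ-refl p = refl

all-update : ∀ κ p k xs → occ p (map proj₁ xs) ≡ 0 → all (agrees (update κ p k)) xs ≡ all (agrees κ) xs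
all-update κ p k xs h = all-cong (agrees (update κ p k)) (agrees κ) xs (λ x m → cong (_==K proj₂ x) (update-other κ p k (proj₁ x) (occ-∉ p (map proj₁ xs) h (∈-map⁺ proj₁ m))))

occ-mid : ∀ p (pre : List Vertex) (a : Kind) (post : List Vertex) → occ p (map proj₁ (pre ++ (p , a) ∷ post)) ≤ 1 →
  occ p (map proj₁ pre) ≡ 0 × occ p (map proj₁ post) ≡ 0
occ-mid p pre a post h rewrite map-++ proj₁ pre ((p , a) ∷ post) | occ-++ p (map proj₁ pre) (p ∷ map proj₁ post) | ≡ᵇ-refl p =
  n≤0⇒n≡0 (≤-trans (m≤m+n _ _) (≤-pred (≤-trans (≤-reflexive (sym (+-suc (occ p (map proj₁ pre)) _))) h))) ,
  n≤0⇒n≡0 (≤-pred (≤-trans (m≤n+m _ (occ p (map proj₁ pre))) h))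

mid↭ : ∀ (pre : List Vertex) a b post → pre ++ a ∷ b ∷ post ↭ b ∷ pre ++ a ∷ post
mid↭ pre a b post = subst (λ z → z ↭ b ∷ pre ++ a ∷ post) (++-assoc pre [ a ] (b ∷ post))
  (↭-trans (shift b (pre ++ [ a ]) post) (prep b (≡⇒↭ (++-assoc pre [ a ] post))))
  where
  ≡⇒↭ : ∀ {xs ys : List Vertex} → xs ≡ ys → xs ↭ ys
  ≡⇒↭ refl = ↭-refl

Labelled⇒↭ : ∀ N t → Labelled N t → labels t ↭ oneTo N
Labelled⇒↭ N t h = isLabelling⇒↭ N (labels t) h

↭⇒Labelled : ∀ N t → labels t ↭ oneTo N → Labelled N t
↭⇒Labelled N t p = ↭⇒isLabelling N (labels t) p

labels-↭ : ∀ t u (v : ℕ) k → vertices t ↭ (v , k) ∷ vertices u → labels t ↭ v ∷ labels u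
labels-↭ t u v k p rewrite labels-vertices t | labels-vertices u = map⁺ proj₁ p

label-range : ∀ M t → Labelled M t → ∀ {l} → l ∈ labels t → Σ ℕ (λ j → l ≡ suc j × j < M)
label-range M t h m = ∈oneTo⁻ (∈-resp-↭ (Labelled⇒↭ M t h) m)

agrees-internal : ∀ a c → T (a ==K intK c) → (a ≡ kB → ⊥) → (a ≡ kI) × (c ≡ uncol)
agrees-internal kI uncol h nb = refl , refl
agrees-internal kB colY h nb = ⊥-elim (nb refl)
agrees-internal kB colN h nb = ⊥-elim (nb refl)

kU-leafK : ∀ c → T (kU ==K leafK c) → c ≡ uncol
kU-leafK uncol h = refl

occ-labels≤1 : ∀ M t → Labelled M t → ∀ p → occ p (map proj₁ (vertices t)) ≤ 1
occ-labels≤1 M t h p = subst (λ z → occ p z ≤ 1) (labels-vertices t)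
  (≤-trans (≤-reflexive (occ-↭ p (Labelled⇒↭ M t h))) (occ-oneTo M p))

-- Let v = M+1 be the largest label and suppose κ
-- declares v a leaf of colour cv.  Pruning v from a tree of Trees (M+1) κ
-- either frees a slot of a tree of Trees M κ (ViaSlot), or turns its parent
-- p into a leaf; then p is internal in κ and the pruned tree lies in
-- Trees M (update κ p kU) (ViaLeaf).
module RemoveTop (M' : ℕ) (κ : ℕ → Kind) (nob : NoColouredInternal κ) (cv : Colour) (κv : κ (suc (suc M')) ≡ leafK cv) where
  M : ℕ
  M = suc M'
  v : ℕ
  v = suc M
  open Graft v cv

  agrees-v : T (κ v ==K kv)
  agrees-v rewrite κv = ==K-refl (leafK cv)

  old-vertices : ∀ t → Labelled M t → T (all notNew (vertices t))
  old-vertices t h = T-all⁺ notNew (vertices t) λ { {l , k} m → go l k m }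
    where
    go : ∀ l k → (l , k) ∈ vertices t → T (notNew (l , k))
    go l k m with label-range M t h (subst (l ∈_) (sym (labels-vertices t)) (∈-map⁺ proj₁ m))
    ... | j , refl , j<M rewrite ≢⇒≡ᵇ (suc j) v (λ e → <-irrefl (suc-injective e) j<M) = tt

  Labelled-graft : ∀ t u → labels u ↭ v ∷ labels t → Labelled M t → Labelled (suc M) u
  Labelled-graft t u p h = ↭⇒Labelled (suc M) u (↭-trans p (↭-trans (prep v (Labelled⇒↭ M t h)) (↭-sym (oneTo-suc↭ M))))

  Labelled-prune : ∀ t u → labels u ↭ v ∷ labels t → Labelled (suc M) u → Labelled M t
  Labelled-prune t u p h = ↭⇒Labelled M t (drop-∷ (↭-trans (↭-sym p) (↭-trans (Labelled⇒↭ (suc M) u h) (oneTo-suc↭ M))))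

  labels-insertLeaf : ∀ t π → labels (insertLeaf t π) ↭ v ∷ labels t
  labels-insertLeaf t π = labels-↭ (insertLeaf t π) t v kv (vertices-insertLeaf t π)

  realises-graft : ∀ t u → vertices u ↭ (v , kv) ∷ vertices t → T (realises κ t) → T (realises κ u)
  realises-graft t u p h = subst T (sym (all-↭ (agrees κ) p)) (from (T-∧ {κ v ==K kv}) (agrees-v , h))

  realises-prune : ∀ t u → vertices u ↭ (v , kv) ∷ vertices t → T (realises κ u) → T (realises κ t)
  realises-prune t u p h = ∧-r {κ v ==K kv} (subst T (all-↭ (agrees κ) p) h)

  labels-ignore-kind : ∀ (pre : List Vertex) p (a b : Kind) rest → map proj₁ (pre ++ (p , a) ∷ rest) ≡ map proj₁ (pre ++ (p , b) ∷ rest)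
  labels-ignore-kind [] p a b rest = refl
  labels-ignore-kind (x ∷ pre) p a b rest = cong (proj₁ x ∷_) (labels-ignore-kind pre p a b rest)

  labels-hangLeaf : ∀ t lp → labels (hangLeaf t lp) ↭ v ∷ labels t
  labels-hangLeaf t lp with vertices-hangLeaf t lp
  ... | pre , post , e1 , e2 rewrite labels-vertices (hangLeaf t lp) | labels-vertices t | e1 | e2 | labels-ignore-kind pre (leafLabel lp) (intK (leafColour lp)) (leafK (leafColour lp)) ((v , kv) ∷ post) =
    map⁺ proj₁ (mid↭ pre _ (v , kv) post)

  realises-hangLeaf⇒ : ∀ t lp → Labelled M t → T (realises κ (hangLeaf t lp)) →
    (κ (leafLabel lp) ≡ kI) × T (realises (update κ (leafLabel lp) kU) t)
  realises-hangLeaf⇒ t lp hl hk with vertices-hangLeaf t lp | occ-labels≤1 M t hl (leafLabel lp)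
  ... | pre , post , e1 , e2 | oc with split3 (agrees κ) pre (leafLabel lp , intK (leafColour lp)) ((v , kv) ∷ post) (subst (λ z → T (all (agrees κ) z)) e2 hk)
  ... | hpre , hp , hrest with agrees-internal (κ (leafLabel lp)) (leafColour lp) hp (nob _)
  ... | κp , cu with occ-mid (leafLabel lp) pre (leafK (leafColour lp)) post (subst (λ z → occ (leafLabel lp) (map proj₁ z) ≤ 1) e1 oc)
  ... | o1 , o2 = κp , subst (λ z → T (all (agrees (update κ (leafLabel lp) kU)) z)) (sym e1)
        (join3 (agrees (update κ (leafLabel lp) kU)) pre _ post
          (subst T (sym (all-update κ (leafLabel lp) kU pre o1)) hpre)
          (subst (λ z → T (z ==K leafK (leafColour lp))) (sym (update-same κ (leafLabel lp) kU)) (subst (λ c → T (kU ==K leafK c)) (sym cu) tt))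
          (subst T (sym (all-update κ (leafLabel lp) kU post o2)) (∧-r {agrees κ (v , kv)} hrest)))

  realises-hangLeaf⇐ : ∀ t lp → Labelled M t → κ (leafLabel lp) ≡ kI → T (realises (update κ (leafLabel lp) kU) t) → T (realises κ (hangLeaf t lp))
  realises-hangLeaf⇐ t lp hl κp hk with vertices-hangLeaf t lp | occ-labels≤1 M t hl (leafLabel lp)
  ... | pre , post , e1 , e2 | oc with split3 (agrees (update κ (leafLabel lp) kU)) pre (leafLabel lp , leafK (leafColour lp)) post (subst (λ z → T (all (agrees (update κ (leafLabel lp) kU)) z)) e1 hk)
  ... | hpre , hp , hpost with kU-leafK (leafColour lp) (subst (λ z → T (z ==K leafK (leafColour lp))) (update-same κ (leafLabel lp) kU) hp)
  ... | cu with occ-mid (leafLabel lp) pre (leafK (leafColour lp)) post (subst (λ z → occ (leafLabel lp) (map proj₁ z) ≤ 1) e1 oc)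
  ... | o1 , o2 = subst (λ z → T (all (agrees κ) z)) (sym e2)
        (join3 (agrees κ) pre _ ((v , kv) ∷ post)
          (subst T (all-update κ (leafLabel lp) kU pre o1) hpre)
          (subst (λ z → T (z ==K intK (leafColour lp))) (sym κp) (subst (λ c → T (kI ==K intK c)) (sym cu) tt))
          (from (T-∧ {agrees κ (v , kv)}) (agrees-v , subst T (all-update κ (leafLabel lp) kU post o2) hpost)))

  v∈labels : ∀ T' → Labelled (suc M) T' → v ∈ labels T'
  v∈labels T' h = ∈-resp-↭ (↭-sym (Labelled⇒↭ (suc M) T' h)) (∈oneTo⁺ {suc M} {M} ≤-refl)

  prune-finds-v : ∀ T' → Labelled (suc M) T' → T (realises κ T') → prune T' ≡ notFound → ⊥
  prune-finds-v (node i c ts) hl hk e with v∈labels (node i c ts) hl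
  ... | here refl with ts | hk | hl
  ...   | [] | _ | hl' with ↭-length (Labelled⇒↭ (suc M) (node i c []) hl')
  ...     | ()
  prune-finds-v (node i c ts) hl hk e | here refl | t ∷ ts' | hk' | _ =
    intK≢leafK c cv (sym (trans (sym κv) (==K⇒≡ _ _ (realises-root κ i c (t ∷ ts') hk'))))
  prune-finds-v (node i c ts) hl hk e | there m with ∈-map⁻ proj₁ (subst (v ∈_) (labelsF-verticesF ts) m)
  ... | (l , k) , mx , refl = nb (==K⇒≡ _ _ kx)
    where
    nbx : T (notNew (l , k))
    nbx = T-all⁻ notNew (verticesF ts) (notFound⇒old (node i c ts) e) mx
    kx : T (leafK cv ==K k)
    kx = subst (λ z → T (z ==K k)) κv (T-all⁻ (agrees κ) (verticesF ts) (realises-children κ i c ts hk) mx)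
    nb : leafK cv ≡ k → ⊥
    nb refl = subst (λ b → T (not b)) (trans (cong (_∧ (leafK cv ==K leafK cv)) (≡ᵇ-refl M')) (leafK-refl cv)) nbx

  labelOf : Fin M → ℕ
  labelOf fp = suc (toℕ fp)

  WithLeafAt : ℕ → Set
  WithLeafAt p = T (isIk (κ p)) × Trees M (update κ p kU)

  ViaSlot ViaLeaf : Set
  ViaSlot = Σ (Trees M κ) (λ s → Slot (proj₁ s))
  ViaLeaf = Σ (Fin M) (λ fp → WithLeafAt (labelOf fp))

  graft-slot-back : ∀ T' t π → prune T' ≡ fromSlot t π → insertLeaf t π ≡ T'
  graft-slot-back T' t π e = trans (cong (unprune T') (sym e)) (unprune-prune T')

  graft-leaf-back : ∀ T' t lp → prune T' ≡ fromLeaf t lp → hangLeaf t lp ≡ T'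
  graft-leaf-back T' t lp e = trans (cong (unprune T') (sym e)) (unprune-prune T')

  labelOf-fromℕ< : ∀ {t} (lp : LeafPos t) j .(j<M : j < M) → leafLabel lp ≡ suc j → leafLabel lp ≡ suc (toℕ (fromℕ< j<M))
  labelOf-fromℕ< lp j j<M ej = trans ej (cong suc (sym (FinP.toℕ-fromℕ< j<M)))

  internal-at : ∀ (t : Tree) (lp : LeafPos t) (kfw : (κ (leafLabel lp) ≡ kI) × T (realises (update κ (leafLabel lp) kU) t)) j .(j<M : j < M) (ej : leafLabel lp ≡ suc j) → T (isIk (κ (suc (toℕ (fromℕ< j<M)))))
  internal-at t lp kfw j j<M ej = subst (λ p → T (isIk (κ p))) (labelOf-fromℕ< lp j j<M ej) (isIk⇐ _ (proj₁ kfw))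

  realises-at : ∀ (t : Tree) (lp : LeafPos t) (kfw : (κ (leafLabel lp) ≡ kI) × T (realises (update κ (leafLabel lp) kU) t)) j .(j<M : j < M) (ej : leafLabel lp ≡ suc j) → T (realises (update κ (suc (toℕ (fromℕ< j<M))) kU) t)
  realises-at t lp kfw j j<M ej = subst (λ p → T (realises (update κ p kU) t)) (labelOf-fromℕ< lp j j<M ej) (proj₂ kfw)

  toViaLeaf : ∀ (t : Tree) (lp : LeafPos t) → Labelled M t → (κ (leafLabel lp) ≡ kI) × T (realises (update κ (leafLabel lp) kU) t) →
        Σ ℕ (λ j → leafLabel lp ≡ suc j × j < M) → ViaSlot ⊎ ViaLeaf
  toViaLeaf t lp hlt kfw (j , ej , j<M) =
    inj₂ (fromℕ< j<M , internal-at t lp kfw j j<M ej , (t , hlt , realises-at t lp kfw j j<M ej))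

  pruneTop′ : (T' : Tree) → Labelled (suc M) T' → T (realises κ T') → (r : Removal) → prune T' ≡ r → ViaSlot ⊎ ViaLeaf
  pruneTop′ T' hl hk notFound e = ⊥-elim (prune-finds-v T' hl hk e)
  pruneTop′ T' hl hk (fromSlot t π) e =
    let eq = graft-slot-back T' t π e in
    inj₁ ((t , Labelled-prune t T' (subst (λ z → labels z ↭ v ∷ labels t) eq (labels-insertLeaf t π)) hl ,
               realises-prune t T' (subst (λ z → vertices z ↭ (v , kv) ∷ vertices t) eq (vertices-insertLeaf t π)) hk) , π)
  pruneTop′ T' hl hk (fromLeaf t lp) e = toViaLeaf t lp hlt (realises-hangLeaf⇒ t lp hlt (subst (λ z → T (realises κ z)) (sym eq) hk)) (label-range M t hlt (leafLabel∈ t lp))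
    where
    eq = graft-leaf-back T' t lp e
    hlt = Labelled-prune t T' (subst (λ z → labels z ↭ v ∷ labels t) eq (labels-hangLeaf t lp)) hl

  pruneTop : Trees (suc M) κ → ViaSlot ⊎ ViaLeaf
  pruneTop (T' , hl , hk) = pruneTop′ T' hl hk (prune T') refl

  labelOf∈ : ∀ fp t → Labelled M t → labelOf fp ∈ labels t
  labelOf∈ fp t hl = ∈-resp-↭ (↭-sym (Labelled⇒↭ M t hl)) (∈oneTo⁺ (FinP.toℕ<n fp))

  leafAt : ∀ fp t → Labelled M t → T (realises (update κ (labelOf fp) kU) t) → Σ (LeafPos t) (λ lp → leafLabel lp ≡ labelOf fp)
  leafAt fp t hl hk = findLeaf (update κ (labelOf fp) kU) (labelOf fp) t hk (update-same κ (labelOf fp) kU) (labelOf∈ fp t hl)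

  graftTop : ViaSlot ⊎ ViaLeaf → Trees (suc M) κ
  graftTop (inj₁ ((t , hl , hk) , π)) = insertLeaf t π , Labelled-graft t _ (labels-insertLeaf t π) hl , realises-graft t _ (vertices-insertLeaf t π) hk
  graftTop (inj₂ (fp , hi , (t , hl , hk))) = hangLeaf t lp , Labelled-graft t _ (labels-hangLeaf t lp) hl ,
        realises-hangLeaf⇐ t lp hl (trans (cong κ elp) (isIk⇒ _ hi)) (subst (λ p → T (realises (update κ p kU) t)) (sym elp) hk)
    where
    lp = proj₁ (leafAt fp t hl hk)
    elp = proj₂ (leafAt fp t hl hk)

  graftTop-leaf : ∀ fp hi t hl hk lp → leafLabel lp ≡ suc (toℕ fp) → proj₁ (graftTop (inj₂ (fp , hi , (t , hl , hk)))) ≡ hangLeaf t lp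
  graftTop-leaf fp hi t hl hk lp e = cong (hangLeaf t) (leafPos-unique t (proj₁ (leafAt fp t hl hk)) lp (trans (proj₂ (leafAt fp t hl hk)) (sym e))
        (subst (λ z → occ (leafLabel (proj₁ (leafAt fp t hl hk))) z ≤ 1) (sym (labels-vertices t)) (occ-labels≤1 M t hl (leafLabel (proj₁ (leafAt fp t hl hk))))))

  graftTop∘pruneTop′ : ∀ T' hl hk r (e : prune T' ≡ r) → proj₁ (graftTop (pruneTop′ T' hl hk r e)) ≡ T'
  graftTop∘pruneTop′ T' hl hk notFound e = ⊥-elim (prune-finds-v T' hl hk e)
  graftTop∘pruneTop′ T' hl hk (fromSlot t π) e = graft-slot-back T' t π e
  graftTop∘pruneTop′ T' hl hk (fromLeaf t lp) e = trans (graft-after-toViaLeaf (realises-hangLeaf⇒ t lp hlt (subst (λ z → T (realises κ z)) (sym eq) hk)) (label-range M t hlt (leafLabel∈ t lp))) eq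
    where
    eq = graft-leaf-back T' t lp e
    hlt = Labelled-prune t T' (subst (λ z → labels z ↭ v ∷ labels t) eq (labels-hangLeaf t lp)) hl
    graft-after-toViaLeaf : ∀ kfw rng → proj₁ (graftTop (toViaLeaf t lp hlt kfw rng)) ≡ hangLeaf t lp
    graft-after-toViaLeaf kfw (j , ej , j<M) = graftTop-leaf (fromℕ< j<M) (internal-at t lp kfw j j<M ej) t hlt (realises-at t lp kfw j j<M ej) lp (labelOf-fromℕ< lp j j<M ej)

  pruneTop∘graftTop-slot : ∀ t hl hk π → pruneTop (graftTop (inj₁ ((t , hl , hk) , π))) ≡ inj₁ ((t , hl , hk) , π)
  pruneTop∘graftTop-slot t hl hk π = prune-outcome-slot (insertLeaf t π) _ _ (prune (insertLeaf t π)) refl (prune-insertLeaf t π (old-vertices t hl))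
    where
    prune-outcome-slot : ∀ T' hl' hk' r e → r ≡ fromSlot t π → pruneTop′ T' hl' hk' r e ≡ inj₁ ((t , hl , hk) , π)
    prune-outcome-slot T' hl' hk' .(fromSlot t π) e refl = cong (λ z → inj₁ ((t , z) , π)) (T×T-irrelevant _ _)

  fromℕ<-label : ∀ {p} fp (rng : Σ ℕ λ j → p ≡ suc j × j < M) → p ≡ suc (toℕ fp) → fromℕ< (proj₂ (proj₂ rng)) ≡ fp
  fromℕ<-label fp (j , e1 , j<M) e2 = FinP.toℕ-injective
    (trans (FinP.toℕ-fromℕ< j<M) (suc-injective (trans (sym e1) e2)))

  ViaLeaf-≡ : ∀ t {f1 f2 : Fin M} a1 a2 b1 b2 → f1 ≡ f2 →
    _≡_ {A = ViaSlot ⊎ ViaLeaf} (inj₂ (f1 , a1 , (t , b1))) (inj₂ (f2 , a2 , (t , b2)))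
  ViaLeaf-≡ t {f1} a1 a2 b1 b2 refl = cong₂ (λ a b → inj₂ (f1 , a , (t , b))) (T-irrelevant a1 a2) (T×T-irrelevant b1 b2)

  pruneTop∘graftTop-leaf : ∀ fp hi t hl hk → pruneTop (graftTop (inj₂ (fp , hi , (t , hl , hk)))) ≡ inj₂ (fp , hi , (t , hl , hk))
  pruneTop∘graftTop-leaf fp hi t hl hk = prune-outcome-leaf (hangLeaf t lp) _ _ (prune (hangLeaf t lp)) refl (prune-hangLeaf t lp (old-vertices t hl))
    where
    lp = proj₁ (leafAt fp t hl hk)
    prune-outcome-leaf : ∀ T' hl' hk' r e → r ≡ fromLeaf t lp → pruneTop′ T' hl' hk' r e ≡ inj₂ (fp , hi , (t , hl , hk))
    prune-outcome-leaf T' hl' hk' .(fromLeaf t lp) e refl = toViaLeaf-same hlt (realises-hangLeaf⇒ t lp hlt (subst (λ z → T (realises κ z)) (sym (graft-leaf-back T' t lp e)) hk')) (label-range M t hlt (leafLabel∈ t lp))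
      where
      hlt = Labelled-prune t T' (subst (λ z → labels z ↭ v ∷ labels t) (graft-leaf-back T' t lp e) (labels-hangLeaf t lp)) hl'
      toViaLeaf-same : ∀ hlt kfw rng → toViaLeaf t lp hlt kfw rng ≡ inj₂ (fp , hi , (t , hl , hk))
      toViaLeaf-same hlt kfw rng@(j , ej , j<M) = ViaLeaf-≡ t _ _ _ _ (fromℕ<-label fp rng (proj₂ (leafAt fp t hl hk)))

  remove-top↔ : Trees (suc M) κ ↔ (ViaSlot ⊎ ViaLeaf)
  remove-top↔ = mk↔ₛ′ pruneTop graftTop fb bf
    where
    fb : ∀ y → pruneTop (graftTop y) ≡ y
    fb (inj₁ ((t , hl , hk) , π)) = pruneTop∘graftTop-slot t hl hk π
    fb (inj₂ (fp , hi , (t , hl , hk))) = pruneTop∘graftTop-leaf fp hi t hl hk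
    bf : ∀ x → graftTop (pruneTop x) ≡ x
    bf (T' , hl , hk) = Trees-≡ _ _ (graftTop∘pruneTop′ T' hl hk (prune T') refl)

mutual
  nSlots : Tree → ℕ
  nSlots (node i c []) = 0
  nSlots (node i c (t ∷ ts)) = suc (length (t ∷ ts)) + nSlotsF (t ∷ ts)

  nSlotsF : List Tree → ℕ
  nSlotsF [] = 0
  nSlotsF (t ∷ ts) = nSlots t + nSlotsF ts

mutual
  Slot↔Fin : ∀ t → Slot t ↔ Fin (nSlots t)
  Slot↔Fin (node i c []) = mk↔ₛ′ (λ { (below ()) }) (λ ()) (λ ()) (λ { (below ()) })
  Slot↔Fin (node i c (t ∷ ts)) = ↔-trans split (↔-trans (↔-refl ⊎-↔ SlotF↔Fin (t ∷ ts)) (↔-sym +↔⊎))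
    where
    split : Slot (node i c (t ∷ ts)) ↔ (Fin (suc (length (t ∷ ts))) ⊎ SlotF (t ∷ ts))
    split = mk↔ₛ′ f g (λ { (inj₁ k) → refl ; (inj₂ p) → refl }) (λ { (atRoot k) → refl ; (below p) → refl })
      where
      f : Slot (node i c (t ∷ ts)) → Fin (suc (length (t ∷ ts))) ⊎ SlotF (t ∷ ts)
      f (atRoot k) = inj₁ k
      f (below p) = inj₂ p
      g : Fin (suc (length (t ∷ ts))) ⊎ SlotF (t ∷ ts) → Slot (node i c (t ∷ ts))
      g (inj₁ k) = atRoot k
      g (inj₂ p) = below p

  SlotF↔Fin : ∀ ts → SlotF ts ↔ Fin (nSlotsF ts)
  SlotF↔Fin [] = mk↔ₛ′ (λ ()) (λ ()) (λ ()) (λ ())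
  SlotF↔Fin (t ∷ ts) = ↔-trans split (↔-trans (Slot↔Fin t ⊎-↔ SlotF↔Fin ts) (↔-sym +↔⊎))
    where
    split : SlotF (t ∷ ts) ↔ (Slot t ⊎ SlotF ts)
    split = mk↔ₛ′ (λ { (hd p) → inj₁ p ; (tl p) → inj₂ p }) (λ { (inj₁ p) → hd p ; (inj₂ p) → tl p })
      (λ { (inj₁ k) → refl ; (inj₂ p) → refl }) (λ { (hd k) → refl ; (tl p) → refl })

-- Counting slots: a tree with N vertices, i of them internal, has N + i - 1
-- slots, since an internal vertex with d children contributes d + 1 of them.
mutual
  nSlots-size : ∀ t → nSlots t + 1 ≡ length (labels t) + nInt t
  nSlots-size (node i c []) = refl
  nSlots-size (node i c (t ∷ ts)) = begin
    suc d + s + 1  ≡⟨ regroup d s ⟩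
    2 + (s + d)    ≡⟨ cong (2 +_) (nSlotsF-size (t ∷ ts)) ⟩
    2 + (l + n)    ≡⟨ cong suc (sym (+-suc l n)) ⟩
    suc l + suc n  ∎
    where
    open ≡-Reasoning
    d = length (t ∷ ts)
    s = nSlotsF (t ∷ ts)
    l = length (labelsF (t ∷ ts))
    n = nIntF (t ∷ ts)
    regroup : ∀ d s → suc d + s + 1 ≡ 2 + (s + d)
    regroup = solve-∀

  nSlotsF-size : ∀ ts → nSlotsF ts + length ts ≡ length (labelsF ts) + nIntF ts
  nSlotsF-size [] = refl
  nSlotsF-size (t ∷ ts) = begin
    (nSlots t + nSlotsF ts) + suc (length ts)
      ≡⟨ regroup (nSlots t) (nSlotsF ts) (length ts) ⟩
    (nSlots t + 1) + (nSlotsF ts + length ts)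
      ≡⟨ cong₂ _+_ (nSlots-size t) (nSlotsF-size ts) ⟩
    (length (labels t) + nInt t) + (length (labelsF ts) + nIntF ts)
      ≡⟨ exchange (length (labels t)) (nInt t) (length (labelsF ts)) (nIntF ts) ⟩
    (length (labels t) + length (labelsF ts)) + (nInt t + nIntF ts)
      ≡⟨ cong (_+ (nInt t + nIntF ts)) (sym (length-++ (labels t))) ⟩
    length (labels t ++ labelsF ts) + (nInt t + nIntF ts) ∎
    where
    open ≡-Reasoning
    regroup : ∀ p f l → (p + f) + suc l ≡ (p + 1) + (f + l)
    regroup = solve-∀
    exchange : ∀ a b c d → (a + b) + (c + d) ≡ (a + c) + (b + d)
    exchange = solve-∀

nInt≡nInternal : ∀ N κ t → Labelled N t → T (realises κ t) → nInt t ≡ nInternal N κ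
nInt≡nInternal N κ t hl hk = begin
  nInt t ≡⟨ nInt-vertices t ⟩
  sum (map (λ p → isInternal (proj₂ p)) (vertices t)) ≡⟨ sum-cong _ _ (vertices t) (λ x m → cong isInternal (sym (==K⇒≡ _ _ (T-all⁻ (agrees κ) (vertices t) hk m)))) ⟩
  sum (map (λ p → isInternal (κ (proj₁ p))) (vertices t)) ≡⟨ cong sum (map-∘ (vertices t)) ⟩
  sum (map (λ l → isInternal (κ l)) (map proj₁ (vertices t))) ≡⟨ cong (λ z → sum (map (λ l → isInternal (κ l)) z)) (sym (labels-vertices t)) ⟩
  sum (map (λ l → isInternal (κ l)) (labels t)) ≡⟨ sum-↭ (map⁺ (λ l → isInternal (κ l)) (Labelled⇒↭ N t hl)) ⟩
  nInternal N κ ∎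
  where open ≡-Reasoning

length-labels : ∀ N t → Labelled N t → length (labels t) ≡ N
length-labels N t hl = trans (↭-length (Labelled⇒↭ N t hl)) (length-oneTo N)

nSlots-value : ∀ M' κ t → Labelled (suc M') t → T (realises κ t) → nSlots t ≡ M' + nInternal (suc M') κ
nSlots-value M' κ t hl hk = +-cancelʳ-≡ 1 _ _ (trans (nSlots-size t) (trans (cong₂ _+_ (length-labels (suc M') t hl) (nInt≡nInternal (suc M') κ t hl hk)) (+-comm 1 (M' + nInternal (suc M') κ))))

sumFin-oneTo : ∀ M (g : ℕ → ℕ) → sumFin {M} (λ fp → g (suc (toℕ fp))) ≡ sum (map g (oneTo M))
sumFin-oneTo zero g = refl
sumFin-oneTo (suc M) g = cong (g 1 +_) (trans (sumFin-oneTo M (λ l → g (suc l))) (cong sum (map-∘ (oneTo M))))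

sumFin-* : ∀ {M} (h : Fin M → ℕ) c → sumFin (λ fp → h fp * c) ≡ sumFin h * c
sumFin-* {zero} h c = refl
sumFin-* {suc M} h c = trans (cong (h Fin.zero * c +_) (sumFin-* (λ p → h (Fin.suc p)) c)) (sym (*-distribʳ-+ c (h Fin.zero) _))

countInternal-update : ∀ κ p ls → κ p ≡ kI → countInternal (update κ p kU) ls + occ p ls ≡ countInternal κ ls
countInternal-update κ p [] e = refl
countInternal-update κ p (l ∷ ls) e with l ≡ᵇ p in eq
... | true rewrite ≡ᵇ⇒≡ l p (subst T (sym eq) tt) | e =
  trans (+-suc (countInternal (update κ p kU) ls) (occ p ls)) (cong suc (countInternal-update κ p ls e))
... | false = trans (+-assoc (isInternal (κ l)) (countInternal (update κ p kU) ls) (occ p ls)) (cong (isInternal (κ l) +_) (countInternal-update κ p ls e))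

occ-oneTo≡1 : ∀ N p → p ∈ oneTo N → occ p (oneTo N) ≡ 1
occ-oneTo≡1 N p m = ≤-antisym (occ-oneTo N p) (occ-∈ p (oneTo N) m)

nInternal-update : ∀ N κ p → κ p ≡ kI → p ∈ oneTo N → nInternal N (update κ p kU) ≡ pred (nInternal N κ)
nInternal-update N κ p e m = sym (trans (cong pred (sym (countInternal-update κ p (oneTo N) e))) (trans (cong (λ z → pred (countInternal (update κ p kU) (oneTo N) + z)) (occ-oneTo≡1 N p m)) (cong pred (+-comm _ 1))))

update-NoColouredInternal : ∀ κ p → NoColouredInternal κ → NoColouredInternal (update κ p kU)
update-NoColouredInternal κ p nb l e with l ≡ᵇ p
... | true = contradiction e λ ()
... | false = nb l e

⊤×↔ : ∀ {X : Set} → (T true × X) ↔ X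
⊤×↔ = mk↔ₛ′ proj₂ (λ x → tt , x) (λ _ → refl) (λ _ → refl)

nInternal-suc : ∀ M κ → nInternal (suc M) κ ≡ isInternal (κ (suc M)) + nInternal M κ
nInternal-suc M κ = sum-↭ (map⁺ (λ l → isInternal (κ l)) (oneTo-suc↭ M))

-- The counting step when the largest label M+2 is a leaf in κ: by the
-- removal bijection and the induction hypothesis for M+1 labels,
--   |Trees (M+2) κ| = L (M+1) i · (M + i) + i · L (M+1) (i-1) = L (M+2) i.
count-top-leaf : ∀ M' → (∀ κ → NoColouredInternal κ → Trees (suc M') κ ↔ Fin (L (suc M') (nInternal (suc M') κ))) →
  ∀ κ (nb : NoColouredInternal κ) cv → κ (suc (suc M')) ≡ leafK cv → Trees (suc (suc M')) κ ↔ Fin (L (suc (suc M')) (nInternal (suc (suc M')) κ))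
count-top-leaf M' IH κ nb cv κv = ↔-trans remove-top↔ (↔-trans (ViaSlot↔ ⊎-↔ ViaLeaf↔) (↔-trans (↔-sym +↔⊎) (Fin-cast total)))
  where
  open RemoveTop M' κ nb cv κv
  i = nInternal (suc M') κ
  -- Each of the L (M+1) i smaller trees has M + i slots.
  ViaSlot↔ : ViaSlot ↔ Fin (L (suc M') i * (M' + i))
  ViaSlot↔ = Σ-const (IH κ nb) (λ s → ↔-trans (Slot↔Fin (proj₁ s)) (Fin-cast (nSlots-value M' κ (proj₁ s) (proj₁ (proj₂ s)) (proj₂ (proj₂ s)))))
  -- For an internal label p the trees with p made a leaf number L (M+1) (i-1);
  -- for other labels there are none.
  WithLeafAt↔ : ∀ fp → WithLeafAt (labelOf fp) ↔ Fin (isInternal (κ (labelOf fp)) * L (suc M') (pred i))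
  WithLeafAt↔ fp with κ (labelOf fp) in e
  ... | kI = ↔-trans ⊤×↔ (↔-trans (IH (update κ (labelOf fp) kU) (update-NoColouredInternal κ (labelOf fp) nb))
             (Fin-cast (trans (cong (L (suc M')) (nInternal-update (suc M') κ (labelOf fp) e (∈oneTo⁺ (FinP.toℕ<n fp)))) (sym (+-identityʳ _)))))
  ... | kY = empty↔ proj₁
  ... | kN = empty↔ proj₁
  ... | kU = empty↔ proj₁
  ... | kB = ⊥-elim (nb _ e)
  ViaLeaf↔ : ViaLeaf ↔ Fin (i * L (suc M') (pred i))
  ViaLeaf↔ = ↔-trans (Σ-Fin↔sum _ WithLeafAt↔) (Fin-cast (trans (sumFin-* (λ fp → isInternal (κ (labelOf fp))) _) (cong (_* L (suc M') (pred i)) (sumFin-oneTo (suc M') (λ l → isInternal (κ l))))))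
  -- By the recursion of L, since the top label is a leaf label of κ.
  total : L (suc M') i * (M' + i) + i * L (suc M') (pred i) ≡ L (suc (suc M')) (nInternal (suc (suc M')) κ)
  total = cong (L (suc (suc M'))) (sym (trans (nInternal-suc (suc M') κ) (cong (_+ i) (trans (cong isInternal κv) (isInternal-leafK cv)))))

-- Relabelling a tree along a permutation σ of [N] maps
-- Trees N (κ ∘ σ) onto Trees N κ; we use it for transpositions, which lets us
-- assume that the largest label is a leaf label of κ.
mutual
  relabel : (ℕ → ℕ) → Tree → Tree
  relabel f (node i c ts) = node (f i) c (relabelF f ts)

  relabelF : (ℕ → ℕ) → List Tree → List Tree
  relabelF f [] = []
  relabelF f (t ∷ ts) = relabel f t ∷ relabelF f ts

mutual
  labels-relabel : ∀ f t → labels (relabel f t) ≡ map f (labels t)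
  labels-relabel f (node i c ts) = cong (f i ∷_) (labelsF-relabelF f ts)

  labelsF-relabelF : ∀ f ts → labelsF (relabelF f ts) ≡ map f (labelsF ts)
  labelsF-relabelF f [] = refl
  labelsF-relabelF f (t ∷ ts) = trans (cong₂ _++_ (labels-relabel f t) (labelsF-relabelF f ts)) (sym (map-++ f (labels t) (labelsF ts)))

relabelVertex : (ℕ → ℕ) → Vertex → Vertex
relabelVertex f x = f (proj₁ x) , proj₂ x

kindOf-relabelF : ∀ f c ts → kindOf c (relabelF f ts) ≡ kindOf c ts
kindOf-relabelF f c [] = refl
kindOf-relabelF f c (t ∷ ts) = refl

mutual
  vertices-relabel : ∀ f t → vertices (relabel f t) ≡ map (relabelVertex f) (vertices t)
  vertices-relabel f (node i c ts) = cong₂ _∷_ (cong (f i ,_) (kindOf-relabelF f c ts)) (verticesF-relabelF f ts)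

  verticesF-relabelF : ∀ f ts → verticesF (relabelF f ts) ≡ map (relabelVertex f) (verticesF ts)
  verticesF-relabelF f [] = refl
  verticesF-relabelF f (t ∷ ts) = trans (cong₂ _++_ (vertices-relabel f t) (verticesF-relabelF f ts)) (sym (map-++ (relabelVertex f) (vertices t) (verticesF ts)))

all-map : ∀ {A B : Set} (g : B → Bool) (h : A → B) xs → all g (map h xs) ≡ all (λ x → g (h x)) xs
all-map g h [] = refl
all-map g h (x ∷ xs) = cong (g (h x) ∧_) (all-map g h xs)

realises-relabel : ∀ κ f t → realises κ (relabel f t) ≡ realises (λ l → κ (f l)) t
realises-relabel κ f t = trans (cong (all (agrees κ)) (vertices-relabel f t)) (all-map (agrees κ) (relabelVertex f) (vertices t))

mutual
  relabel-involutive : ∀ f → (∀ l → f (f l) ≡ l) → ∀ t → relabel f (relabel f t) ≡ t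
  relabel-involutive f h (node i c ts) = cong₂ (λ a b → node a c b) (h i) (relabelF-involutive f h ts)

  relabelF-involutive : ∀ f → (∀ l → f (f l) ≡ l) → ∀ ts → relabelF f (relabelF f ts) ≡ ts
  relabelF-involutive f h [] = refl
  relabelF-involutive f h (t ∷ ts) = cong₂ _∷_ (relabel-involutive f h t) (relabelF-involutive f h ts)

transposition : ℕ → ℕ → ℕ → ℕ
transposition j v l = if l ≡ᵇ j then v else (if l ≡ᵇ v then j else l)

transposition-involutive : ∀ j v l → transposition j v (transposition j v l) ≡ l
transposition-involutive j v l with l ≡ᵇ j in e1
... | true with v ≡ᵇ j in e2
...   | true = trans (≡ᵇ-true e2) (sym (≡ᵇ-true e1))
...   | false rewrite ≡ᵇ-refl v = sym (≡ᵇ-true e1)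
transposition-involutive j v l | false with l ≡ᵇ v in e3
... | true rewrite ≡ᵇ-refl j = sym (≡ᵇ-true e3)
... | false rewrite e1 | e3 = refl

transposition-oneTo : ∀ N j v → j ∈ oneTo N → v ∈ oneTo N → ∀ l → l ∈ oneTo N → transposition j v l ∈ oneTo N
transposition-oneTo N j v jm vm l lm with l ≡ᵇ j
... | true = vm
... | false with l ≡ᵇ v
...   | true = jm
...   | false = lm

transposition-↭ : ∀ N j v → j ∈ oneTo N → v ∈ oneTo N → map (transposition j v) (oneTo N) ↭ oneTo N
transposition-↭ N j v jm vm = covers⇒↭ N _ (trans (length-map (transposition j v) (oneTo N)) (length-oneTo N))
  (λ k k<N → subst (_∈ map (transposition j v) (oneTo N)) (transposition-involutive j v (suc k)) (∈-map⁺ (transposition j v) (transposition-oneTo N j v jm vm (suc k) (∈oneTo⁺ k<N))))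

module Transpose (N j v : ℕ) (jm : j ∈ oneTo N) (vm : v ∈ oneTo N) (κ : ℕ → Kind) where
  σ : ℕ → ℕ
  σ = transposition j v

  κσ : ℕ → Kind
  κσ l = κ (σ l)

  Labelled-relabel : ∀ t → Labelled N t → Labelled N (relabel σ t)
  Labelled-relabel t hl = ↭⇒Labelled N (relabel σ t) (subst (_↭ oneTo N) (sym (labels-relabel σ t)) (↭-trans (map⁺ σ (Labelled⇒↭ N t hl)) (transposition-↭ N j v jm vm)))

  realises-transpose⁺ : ∀ t → T (realises κ t) → T (realises κσ (relabel σ t))
  realises-transpose⁺ t hk = subst T (sym (trans (realises-relabel κσ σ t) (all-cong _ _ (vertices t) (λ x _ → cong (λ l → κ l ==K proj₂ x) (transposition-involutive j v (proj₁ x)))))) hk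

  realises-transpose⁻ : ∀ t → T (realises κσ t) → T (realises κ (relabel σ t))
  realises-transpose⁻ t hk = subst T (sym (realises-relabel κ σ t)) hk

  transpose↔ : Trees N κ ↔ Trees N κσ
  transpose↔ = mk↔ₛ′ (λ (t , hl , hk) → relabel σ t , Labelled-relabel t hl , realises-transpose⁺ t hk) (λ (t , hl , hk) → relabel σ t , Labelled-relabel t hl , realises-transpose⁻ t hk)
    (λ (t , hl , hk) → Trees-≡ _ _ (relabel-involutive σ (transposition-involutive j v) t)) (λ (t , hl , hk) → Trees-≡ _ _ (relabel-involutive σ (transposition-involutive j v) t))

  nInternal-transpose : nInternal N κσ ≡ nInternal N κ
  nInternal-transpose = trans (cong sum (map-∘ (oneTo N))) (sum-↭ (map⁺ (λ l → isInternal (κ l)) (transposition-↭ N j v jm vm)))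

-- Either
-- some label is not internal in κ (then a transposition makes the largest
-- label a leaf label and the removal bijection applies), or all labels are
-- internal and there are no trees at all, since every tree has a leaf.

leafEx : ∀ t → Σ Vertex (λ x → x ∈ vertices t × isInternal (proj₂ x) ≡ 0)
leafEx (node i c []) = (i , leafK c) , here refl , isInternal-leafK c
leafEx (node i c (t ∷ ts)) with leafEx t
... | x , m , e = x , there (∈-++⁺ˡ m) , e

allI-empty : ∀ N κ → (∀ l → l ∈ oneTo N → κ l ≡ kI) → Trees N κ → ⊥
allI-empty N κ h (t , hl , hk) with leafEx t
... | (l , k) , m , e = 1≢0 (trans (cong isInternal (trans (sym (h l lm)) kl)) e)
  where
  1≢0 : 1 ≡ 0 → ⊥
  1≢0 ()
  lm : l ∈ oneTo N
  lm = ∈-resp-↭ (Labelled⇒↭ N t hl) (subst (l ∈_) (sym (labels-vertices t)) (∈-map⁺ proj₁ m))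
  kl : κ l ≡ k
  kl = ==K⇒≡ _ _ (T-all⁻ (agrees κ) (vertices t) hk m)

L-zero : ∀ M i → suc M ≤ i → L (suc M) i ≡ 0
L-zero zero (suc i) _ = refl
L-zero (suc M) (suc i) (s≤s le) rewrite L-zero M (suc i) (≤-trans le (n≤1+n _)) | L-zero M i le = *-zeroʳ (suc i)

cnt-allI : ∀ N κ → (∀ l → l ∈ oneTo N → κ l ≡ kI) → nInternal N κ ≡ N
cnt-allI N κ h = trans (sum-cong _ (λ _ → 1) (oneTo N) (λ l m → cong isInternal (h l m))) (trans (sum1 (oneTo N)) (length-oneTo N))
  where
  sum1 : ∀ (ls : List ℕ) → sum (map (λ _ → 1) ls) ≡ length ls
  sum1 [] = refl
  sum1 (x ∷ ls) = cong suc (sum1 ls)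

isKI? : ∀ k → (k ≡ kI) ⊎ (k ≡ kI → ⊥)
isKI? kI = inj₁ refl
isKI? kY = inj₂ (λ ())
isKI? kN = inj₂ (λ ())
isKI? kU = inj₂ (λ ())
isKI? kB = inj₂ (λ ())

search : ∀ (κ : ℕ → Kind) (ls : List ℕ) → (Σ ℕ λ j → j ∈ ls × (κ j ≡ kI → ⊥)) ⊎ (∀ l → l ∈ ls → κ l ≡ kI)
search κ [] = inj₂ (λ l ())
search κ (x ∷ ls) with isKI? (κ x)
... | inj₂ ne = inj₁ (x , here refl , ne)
... | inj₁ e with search κ ls
...   | inj₁ (j , m , ne) = inj₁ (j , there m , ne)
...   | inj₂ h = inj₂ (λ { l (here refl) → e ; l (there m) → h l m })

leafOf : ∀ k → (k ≡ kI → ⊥) → (k ≡ kB → ⊥) → Σ Colour (λ c → k ≡ leafK c)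
leafOf kI a b = ⊥-elim (a refl)
leafOf kY a b = colY , refl
leafOf kN a b = colN , refl
leafOf kU a b = uncol , refl
leafOf kB a b = ⊥-elim (b refl)

rng-up : ∀ {N l} → l ∈ oneTo N → l ∈ oneTo (suc N)
rng-up m with ∈oneTo⁻ m
... | j , refl , j<N = ∈oneTo⁺ (≤-trans j<N (n≤1+n _))

lF0 : ∀ ts → labelsF ts ≡ [] → ts ≡ []
lF0 [] e = refl
lF0 (node i c ts' ∷ ts) ()

count-Trees-one : ∀ κ cv → κ 1 ≡ leafK cv → Trees 1 κ ↔ Fin 1
count-Trees-one κ cv e = mk↔ₛ′ (λ _ → Fin.zero) (λ _ → (node 1 cv [] , tt , k1)) (λ { Fin.zero → refl ; (Fin.suc ()) }) rt
  where
  k1 : T (realises κ (node 1 cv []))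
  k1 = subst (λ z → T ((z ==K leafK cv) ∧ true)) (sym e) (subst (λ b → T (b ∧ true)) (sym (leafK-refl cv)) tt)
  rt : ∀ x → (node 1 cv [] , tt , k1) ≡ x
  rt (node i c ts , hl , hk) with ↭-singleton-inv (Labelled⇒↭ 1 (node i c ts) hl)
  ... | eq with ∷-injective eq
  ... | refl , eq′ with lF0 ts eq′
  ... | refl with leafK-inj cv c (subst (λ z → T (z ==K leafK c)) e (∧-l hk))
  ... | refl = Trees-≡ _ _ refl

transposition-v : ∀ j v → transposition j v v ≡ j
transposition-v j v with v ≡ᵇ j in e1
... | true = ≡ᵇ-true e1
... | false rewrite ≡ᵇ-refl v = refl

count-Trees-step : ∀ M' → (∀ κ → NoColouredInternal κ → Trees (suc M') κ ↔ Fin (L (suc M') (nInternal (suc M') κ))) →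
  ∀ κ → NoColouredInternal κ → Trees (suc (suc M')) κ ↔ Fin (L (suc (suc M')) (nInternal (suc (suc M')) κ))
count-Trees-step M' IH κ nb with κ (suc (suc M')) in e
... | kY = count-top-leaf M' IH κ nb colY e
... | kN = count-top-leaf M' IH κ nb colN e
... | kU = count-top-leaf M' IH κ nb uncol e
... | kB = ⊥-elim (nb _ e)
... | kI with search κ (oneTo (suc M'))
...   | inj₂ h = ↔-trans (empty↔ (allI-empty N κ h')) (Fin-cast (sym (L-zero (suc M') _ (≤-reflexive (sym (cnt-allI N κ h'))))))
  where
  N = suc (suc M')
  h' : ∀ l → l ∈ oneTo N → κ l ≡ kI
  h' l m with ∈-resp-↭ (oneTo-suc↭ (suc M')) m
  ... | here refl = e
  ... | there m' = h l m'
...   | inj₁ (j , jm , ne) with leafOf (κ j) ne (nb j)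
...     | cv , ecv = ↔-trans transpose↔ (↔-trans (count-top-leaf M' IH κσ nbσ cv κσv) (Fin-cast (cong (L N) nInternal-transpose)))
  where
  N = suc (suc M')
  vm : suc (suc M') ∈ oneTo N
  vm = ∈oneTo⁺ ≤-refl
  open Transpose N j (suc (suc M')) (rng-up jm) vm κ
  nbσ : NoColouredInternal κσ
  nbσ l = nb (σ l)
  κσv : κσ (suc (suc M')) ≡ leafK cv
  κσv = trans (cong κ (transposition-v j (suc (suc M')))) ecv

count-Trees : ∀ N κ → NoColouredInternal κ → Trees N κ ↔ Fin (L N (nInternal N κ))
count-Trees zero κ nb = empty↔ (λ { (node i c ts , hl , hk) → 1+n≢0 (length-labels 0 (node i c ts) hl) })
count-Trees (suc zero) κ nb with κ 1 in e
... | kI = empty↔ (allI-empty 1 κ (λ { l (here refl) → e }))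
... | kB = ⊥-elim (nb 1 e)
... | kY = count-Trees-one κ colY e
... | kN = count-Trees-one κ colN e
... | kU = count-Trees-one κ uncol e
count-Trees (suc (suc M')) κ nb = count-Trees-step M' (count-Trees (suc M')) κ nb

choose : ℕ → ℕ → ℕ
choose _ zero = 1
choose zero (suc k) = 0
choose (suc n) (suc k) = choose n k + choose n (suc k)

choose-< : ∀ a b → a < b → choose a b ≡ 0
choose-< zero (suc b) _ = refl
choose-< (suc a) (suc b) (s≤s h) rewrite choose-< a b h | choose-< a (suc b) (≤-trans h (n≤1+n b)) = refl

choose-1 : ∀ m → choose m 1 ≡ m
choose-1 zero = refl
choose-1 (suc m) = cong suc (choose-1 m)

∸-suc : ∀ m s → s < m → m ∸ s ≡ suc (m ∸ suc s)
∸-suc (suc m) zero _ = refl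
∸-suc (suc m) (suc s) (s≤s h) = ∸-suc m s h

choose-absorb : ∀ m s → suc s * choose m (suc s) ≡ (m ∸ s) * choose m s
choose-absorb zero zero = refl
choose-absorb zero (suc s) = *-zeroʳ (suc (suc s))
choose-absorb (suc m) zero rewrite choose-1 m = trans (+-identityʳ (suc m)) (sym (*-identityʳ (suc m)))
choose-absorb (suc m) (suc s) with <-≤-connex s m
... | inj₁ s<m = begin
  suc (suc s) * (choose m (suc s) + choose m (suc (suc s)))
    ≡⟨ *-distribˡ-+ (suc (suc s)) (choose m (suc s)) _ ⟩
  suc (suc s) * choose m (suc s) + suc (suc s) * choose m (suc (suc s))
    ≡⟨ cong (λ z → suc (suc s) * choose m (suc s) + z) (choose-absorb m (suc s)) ⟩
  suc (suc s) * B1 + (m ∸ suc s) * B1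
    ≡⟨ regroup s (m ∸ suc s) B1 ⟩
  suc s * B1 + suc (m ∸ suc s) * B1
    ≡⟨ cong₂ _+_ (choose-absorb m s) (cong (_* B1) (sym (∸-suc m s s<m))) ⟩
  (m ∸ s) * choose m s + (m ∸ s) * B1
    ≡⟨ sym (*-distribˡ-+ (m ∸ s) (choose m s) B1) ⟩
  (m ∸ s) * (choose m s + B1) ∎
  where
  open ≡-Reasoning
  B1 = choose m (suc s)
  regroup : ∀ s d b → suc (suc s) * b + d * b ≡ suc s * b + suc d * b
  regroup = solve-∀
... | inj₂ m≤s rewrite choose-< m (suc s) (s≤s m≤s) | choose-< m (suc (suc s)) (s≤s (≤-trans m≤s (n≤1+n s))) | m≤n⇒m∸n≡0 m≤s
  = *-zeroʳ (suc (suc s))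

-- chooseP M t = C(M, t-1), with the convention C(M, -1) = 0.
chooseP : ℕ → ℕ → ℕ
chooseP M zero = 0
chooseP M (suc t) = choose M t

chooseP-pascal : ∀ M t → chooseP (suc M) (suc t) ≡ chooseP M (suc t) + chooseP M t
chooseP-pascal M zero = refl
chooseP-pascal M (suc t) = +-comm (choose M t) (choose M (suc t))

choose-diag : ∀ n → choose n n ≡ 1
choose-diag zero = refl
choose-diag (suc n) rewrite choose-diag n | choose-< n (suc n) ≤-refl = refl

choose-sym : ∀ r s → choose (r + s) r ≡ choose (r + s) s
choose-sym zero s = sym (choose-diag s)
choose-sym (suc r) zero rewrite +-identityʳ r = choose-diag (suc r)
choose-sym (suc r) (suc s) = begin
  choose (r + suc s) r + choose (r + suc s) (suc r) ≡⟨ cong₂ _+_ (choose-sym r (suc s)) (trans (cong (λ z → choose z (suc r)) (+-suc r s)) (trans (choose-sym (suc r) s) (cong (λ z → choose z s) (sym (+-suc r s))))) ⟩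
  choose (r + suc s) (suc s) + choose (r + suc s) s ≡⟨ +-comm (choose (r + suc s) (suc s)) (choose (r + suc s) s) ⟩
  choose (r + suc s) s + choose (r + suc s) (suc s) ∎
  where open ≡-Reasoning

-- The recurrence of L, satisfied by t ↦ C(m, t-1) up to the factor m+2:
--   C(m, t-1)(m+1+t) + t C(m, t-2) = (m+2) C(m+1, t-1).
chooseP-recurrence : ∀ m t → chooseP m t * (suc m + t) + t * chooseP m (pred t) ≡ suc (suc m) * chooseP (suc m) t
chooseP-recurrence m zero = sym (*-zeroʳ (suc (suc m)))
chooseP-recurrence m (suc zero) = regroup m
  where
  regroup : ∀ m → 1 * (suc m + 1) + 1 * 0 ≡ suc (suc m) * 1
  regroup = solve-∀
chooseP-recurrence m (suc (suc s')) with <-≤-connex m s'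
... | inj₁ m<s' rewrite choose-< m s' m<s' | choose-< m (suc s') (≤-trans m<s' (n≤1+n s')) = regroup₀ (suc m + suc (suc s')) s' m
  where
  regroup₀ : ∀ a b c → 0 * a + suc (suc b) * 0 ≡ suc (suc c) * (0 + 0)
  regroup₀ = solve-∀
... | inj₂ s'≤m with m≤n⇒∃[o]m+o≡n s'≤m
...   | d , refl = begin
  B1 * (suc (s' + d) + suc (suc s')) + suc (suc s') * B0 ≡⟨ regroup₁ s' d B0 B1 ⟩
  suc s' * B1 + (B1 * (s' + d + 2) + (s' + 2) * B0) ≡⟨ cong (λ z → z + (B1 * (s' + d + 2) + (s' + 2) * B0)) (trans (choose-absorb (s' + d) s') (cong (_* B0) (m+n∸m≡n s' d))) ⟩
  d * B0 + (B1 * (s' + d + 2) + (s' + 2) * B0) ≡⟨ regroup₂ s' d B0 B1 ⟩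
  suc (suc (s' + d)) * (B0 + B1) ∎
  where
  open ≡-Reasoning
  B0 = choose (s' + d) s'
  B1 = choose (s' + d) (suc s')
  regroup₁ : ∀ s d b0 b1 → b1 * (suc (s + d) + suc (suc s)) + suc (suc s) * b0 ≡ suc s * b1 + (b1 * (s + d + 2) + (s + 2) * b0)
  regroup₁ = solve-∀
  regroup₂ : ∀ s d b0 b1 → d * b0 + (b1 * (s + d + 2) + (s + 2) * b0) ≡ suc (suc (s + d)) * (b0 + b1)
  regroup₂ = solve-∀

L-closed-form : ∀ m t → L (suc (suc m)) t ≡ suc m ! * chooseP m t
L-closed-form zero zero = refl
L-closed-form zero (suc zero) = refl
L-closed-form zero (suc (suc t)) = *-zeroʳ (suc (suc t))
L-closed-form (suc m) t rewrite L-closed-form m t | L-closed-form m (pred t) = begin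
  F * chooseP m t * (suc m + t) + t * (F * chooseP m (pred t)) ≡⟨ regroup₁ F (chooseP m t) (suc m + t) t (chooseP m (pred t)) ⟩
  F * (chooseP m t * (suc m + t) + t * chooseP m (pred t)) ≡⟨ cong (F *_) (chooseP-recurrence m t) ⟩
  F * (suc (suc m) * chooseP (suc m) t) ≡⟨ regroup₂ F (suc (suc m)) (chooseP (suc m) t) ⟩
  (F + suc m * F) * chooseP (suc m) t ∎
  where
  open ≡-Reasoning
  F = suc m !
  regroup₁ : ∀ f a b c d → f * a * b + c * (f * d) ≡ f * (a * b + c * d)
  regroup₁ = solve-∀
  regroup₂ : ∀ f s e → f * (s * e) ≡ (s * f) * e
  regroup₂ = solve-∀

-- The labels q+x+1, …, q+x+n of a tree in Γ_{n,x,q} are internal, Y-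
-- or N-leaves; recording these kinds gives a word w ∈ {I,Y,N}^n, and with the
-- forced kinds of the first q+x labels a kind assignment κ_w.  Summing the
-- indicators of "internal" and "Y-leaf" over κ_w computes the statistic.
data Letter : Set where
  tI tY tN : Letter

letterKind : Letter → Kind
letterKind tI = kI
letterKind tY = kY
letterKind tN = kN

kindLetter : Kind → Letter
kindLetter kI = tI
kindLetter kY = tY
kindLetter _ = tN

kindLetter-letterKind : ∀ a → kindLetter (letterKind a) ≡ a
kindLetter-letterKind tI = refl
kindLetter-letterKind tY = refl
kindLetter-letterKind tN = refl

letterKind-kindLetter : ∀ k → T (isIYNk k) → letterKind (kindLetter k) ≡ k
letterKind-kindLetter kI _ = refl
letterKind-kindLetter kY _ = refl
letterKind-kindLetter kN _ = refl

isIYNk-letterKind : ∀ a → T (isIYNk (letterKind a))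
isIYNk-letterKind tI = tt
isIYNk-letterKind tY = tt
isIYNk-letterKind tN = tt

wordKind : ∀ {n} → Vec Letter n → ℕ → Kind
wordKind [] _ = kU
wordKind (a ∷ w) zero = letterKind a
wordKind (a ∷ w) (suc j) = wordKind w j

wordKind-lookup : ∀ {n} (w : Vec Letter n) (i : Fin n) → wordKind w (toℕ i) ≡ letterKind (lookup w i)
wordKind-lookup (a ∷ w) Fin.zero = refl
wordKind-lookup (a ∷ w) (Fin.suc i) = wordKind-lookup w i

nIY : ∀ {n} → Vec Letter n → ℕ
nIY [] = 0
nIY (tI ∷ w) = suc (nIY w)
nIY (tY ∷ w) = suc (nIY w)
nIY (tN ∷ w) = nIY w

nI : ∀ {n} → Vec Letter n → ℕ
nI [] = 0
nI (tI ∷ w) = suc (nI w)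
nI (tY ∷ w) = nI w
nI (tN ∷ w) = nI w

wordAssignment : ℕ → ℕ → ∀ {n} → Vec Letter n → ℕ → Kind
wordAssignment x q w l = if l ≤ᵇ q then kU else (if l ≤ᵇ q + x then kI else wordKind w (l ∸ suc (q + x)))

upper-label : ∀ n x q l → q + x < l → l ≤ n + x + q → (l ∸ suc (q + x)) < n × suc (q + x + (l ∸ suc (q + x))) ≡ l
upper-label n x q l h1 h2 = lt , eq
  where
  i = l ∸ suc (q + x)
  e0 : i + suc (q + x) ≡ l
  e0 = m∸n+n≡m h1
  eq : suc (q + x + i) ≡ l
  eq = trans (trans (cong suc (+-comm (q + x) i)) (sym (+-suc i (q + x)))) e0
  lt : i < n
  lt = +-cancelʳ-≤ (q + x) (suc i) n (subst₂ _≤_ (+-suc i (q + x)) (regroup n x q) (subst (_≤ n + x + q) (sym e0) h2))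
    where
    regroup : ∀ n x q → n + x + q ≡ n + (q + x)
    regroup = solve-∀

wordKind-letter : ∀ {n} (w : Vec Letter n) i → i < n → Σ Letter (λ a → wordKind w i ≡ letterKind a)
wordKind-letter (a ∷ w) zero _ = a , refl
wordKind-letter (a ∷ w) (suc i) (s≤s h) = wordKind-letter w i h

module Assignment (n x q : ℕ) where
  N : ℕ
  N = n + x + q

  κ : Vec Letter n → ℕ → Kind
  κ w = wordAssignment x q w

  κ-lo : ∀ w l → l ≤ q → κ w l ≡ kU
  κ-lo w l h rewrite ≤ᵇ-true h = refl

  κ-mid : ∀ w l → q < l → l ≤ q + x → κ w l ≡ kI
  κ-mid w l h1 h2 rewrite ≤ᵇ-false h1 | ≤ᵇ-true h2 = refl

  κ-hi : ∀ w l → q + x < l → κ w l ≡ wordKind w (l ∸ suc (q + x))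
  κ-hi w l h rewrite ≤ᵇ-false (≤-<-trans (m≤m+n q x) h) | ≤ᵇ-false h = refl

  allowed-lo : ∀ l k → l ≤ q → T (kindAllowed x q (l , k)) → k ≡ kU
  allowed-lo l k le h rewrite ≤ᵇ-true le = isUk⇒ k h

  allowed-mid : ∀ l k → q < l → l ≤ q + x → T (kindAllowed x q (l , k)) → k ≡ kI
  allowed-mid l k lt le h rewrite ≤ᵇ-false lt | ≤ᵇ-true le = isIk⇒ k h

  allowed-hi : ∀ l k → q + x < l → T (kindAllowed x q (l , k)) → T (isIYNk k)
  allowed-hi l k lt h rewrite ≤ᵇ-false (≤-<-trans (m≤m+n q x) lt) | ≤ᵇ-false lt = h

  NoColouredInternal-word : ∀ w → NoColouredInternal (κ w)
  NoColouredInternal-word w l e with ≤-<-connex l q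
  ... | inj₁ le = contradiction (trans (sym (κ-lo w l le)) e) λ ()
  ... | inj₂ lt with ≤-<-connex l (q + x)
  ...   | inj₁ le = contradiction (trans (sym (κ-mid w l lt le)) e) λ ()
  ...   | inj₂ lt′ = wordKind≢kB w (l ∸ suc (q + x)) (trans (sym (κ-hi w l lt′)) e)
    where
    wordKind≢kB : ∀ {m} (w : Vec Letter m) j → wordKind w j ≡ kB → ⊥
    wordKind≢kB [] j ()
    wordKind≢kB (tI ∷ w) zero ()
    wordKind≢kB (tY ∷ w) zero ()
    wordKind≢kB (tN ∷ w) zero ()
    wordKind≢kB (a ∷ w) (suc j) e = wordKind≢kB w j e

  allowed-κ : ∀ w l → l ≤ N → T (kindAllowed x q (l , κ w l))
  allowed-κ w l l≤N with ≤-<-connex l q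
  ... | inj₁ le rewrite ≤ᵇ-true le = tt
  ... | inj₂ lt with ≤-<-connex l (q + x)
  ...   | inj₁ le rewrite ≤ᵇ-false lt | ≤ᵇ-true le = tt
  ...   | inj₂ lt′ rewrite ≤ᵇ-false lt | ≤ᵇ-false lt′
    with wordKind-letter w (l ∸ suc (q + x)) (proj₁ (upper-label n x q l lt′ l≤N))
  ... | a , e = subst (λ z → T (isIYNk z)) (sym e) (isIYNk-letterKind a)

weight : Kind → ℕ
weight k = isInternal k + isLeafY k

wordSum : (Kind → ℕ) → ∀ {m} → Vec Letter m → ℕ
wordSum h [] = 0
wordSum h (a ∷ w) = h (letterKind a) + wordSum h w

module AssignmentSum (n x q : ℕ) (h : Kind → ℕ) (h0 : h kU ≡ 0) (h1 : h kI ≡ 1) where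
  open Assignment n x q

  label-shift : ∀ q x j → q + (x + suc j) ≡ j + suc (q + x)
  label-shift = solve-∀

  sum-wordKind : ∀ {m} (w : Vec Letter m) → sum (map (λ l → h (wordKind w (l ∸ 1))) (oneTo m)) ≡ wordSum h w
  sum-wordKind [] = refl
  sum-wordKind {suc m} (a ∷ w) = cong (h (letterKind a) +_) (trans (cong sum (sym (map-∘ (oneTo m))))
      (trans (sum-cong (λ l → h (wordKind (a ∷ w) (suc l ∸ 1))) (λ l → h (wordKind w (l ∸ 1))) (oneTo m) λ l mm → cong h (lem l mm)) (sum-wordKind w)))
    where
    lem : ∀ l → l ∈ oneTo m → wordKind (a ∷ w) (suc l ∸ 1) ≡ wordKind w (l ∸ 1)
    lem l mm with ∈oneTo⁻ mm
    ... | j , refl , _ = refl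

  sum-assignment : ∀ w → sum (map (λ l → h (κ w l)) (oneTo N)) ≡ x + wordSum h w
  sum-assignment w = begin
    sum (map G (oneTo N)) ≡⟨ cong (λ z → sum (map G (oneTo z))) (regroup n x q) ⟩
    sum (map G (oneTo (q + (x + n)))) ≡⟨ cong (λ z → sum (map G z)) (oneTo-+ q (x + n)) ⟩
    sum (map G (oneTo q ++ map (q +_) (oneTo (x + n)))) ≡⟨ cong (λ z → sum (map G (oneTo q ++ map (q +_) z))) (oneTo-+ x n) ⟩
    sum (map G (oneTo q ++ map (q +_) (oneTo x ++ map (x +_) (oneTo n)))) ≡⟨ cong (λ z → sum (map G (oneTo q ++ z))) (map-++ (q +_) (oneTo x) _) ⟩
    sum (map G (oneTo q ++ (map (q +_) (oneTo x) ++ map (q +_) (map (x +_) (oneTo n))))) ≡⟨ cong sum (map-++ G (oneTo q) _) ⟩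
    sum (map G (oneTo q) ++ map G (map (q +_) (oneTo x) ++ map (q +_) (map (x +_) (oneTo n)))) ≡⟨ sum-++ (map G (oneTo q)) _ ⟩
    sum (map G (oneTo q)) + sum (map G (map (q +_) (oneTo x) ++ map (q +_) (map (x +_) (oneTo n)))) ≡⟨ cong (sum (map G (oneTo q)) +_) (trans (cong sum (map-++ G (map (q +_) (oneTo x)) _)) (sum-++ (map G (map (q +_) (oneTo x))) _)) ⟩
    sum (map G (oneTo q)) + (sum (map G (map (q +_) (oneTo x))) + sum (map G (map (q +_) (map (x +_) (oneTo n))))) ≡⟨ cong₂ (λ a b → a + b) s1 (cong₂ _+_ s2 s3) ⟩
    0 + (x + wordSum h w) ∎
    where
    open ≡-Reasoning
    G : ℕ → ℕ
    G l = h (κ w l)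
    regroup : ∀ n x q → n + x + q ≡ q + (x + n)
    regroup = solve-∀
    s1 : sum (map G (oneTo q)) ≡ 0
    s1 = trans (sum-const G 0 (oneTo q) (λ l m → trans (cong h (κ-lo w l (lo l m))) h0)) (*-zeroʳ (length (oneTo q)))
      where
      lo : ∀ l → l ∈ oneTo q → l ≤ q
      lo l m with ∈oneTo⁻ m
      ... | j , refl , j<q = j<q
    s2 : sum (map G (map (q +_) (oneTo x))) ≡ x
    s2 = trans (cong sum (sym (map-∘ (oneTo x)))) (trans (sum-const _ 1 (oneTo x) (λ l m → trans (cong h (mid l m)) h1)) (trans (*-identityʳ _) (length-oneTo x)))
      where
      mid : ∀ l → l ∈ oneTo x → κ w (q + l) ≡ kI
      mid l m with ∈oneTo⁻ m
      ... | j , refl , j<x = κ-mid w (q + suc j) (≤-trans (s≤s (m≤m+n q j)) (≤-reflexive (sym (+-suc q j)))) (+-monoʳ-≤ q j<x)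
    s3 : sum (map G (map (q +_) (map (x +_) (oneTo n)))) ≡ wordSum h w
    s3 = trans (cong sum (trans (sym (map-∘ (map (x +_) (oneTo n)))) (sym (map-∘ (oneTo n)))))
      (trans (sum-cong _ _ (oneTo n) (λ l m → cong h (hi l m))) (sum-wordKind w))
      where
      hi : ∀ l → l ∈ oneTo n → κ w (q + (x + l)) ≡ wordKind w (l ∸ 1)
      hi l m with ∈oneTo⁻ m
      ... | j , refl , j<n = trans (κ-hi w _ (subst (q + x <_) (sym (trans (label-shift q x j) (+-comm j _))) (s≤s (m≤m+n (q + x) j))))
            (cong (wordKind w) (trans (cong (_∸ suc (q + x)) (label-shift q x j)) (m+n∸n≡m j (suc (q + x)))))

wordSum-weight : ∀ {m} (w : Vec Letter m) → wordSum weight w ≡ nIY w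
wordSum-weight [] = refl
wordSum-weight (tI ∷ w) = cong suc (wordSum-weight w)
wordSum-weight (tY ∷ w) = cong suc (wordSum-weight w)
wordSum-weight (tN ∷ w) = wordSum-weight w

wordSum-isInternal : ∀ {m} (w : Vec Letter m) → wordSum isInternal w ≡ nI w
wordSum-isInternal [] = refl
wordSum-isInternal (tI ∷ w) = cong suc (wordSum-isInternal w)
wordSum-isInternal (tY ∷ w) = wordSum-isInternal w
wordSum-isInternal (tN ∷ w) = wordSum-isInternal w

kindAt : ℕ → List Vertex → Kind
kindAt l [] = kU
kindAt l ((l' , k) ∷ xs) = if l' ≡ᵇ l then k else kindAt l xs

kindAt∈ : ∀ l (xs : List Vertex) → l ∈ map proj₁ xs → (l , kindAt l xs) ∈ xs
kindAt∈ l ((l' , k) ∷ xs) m with l' ≡ᵇ l in e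
... | true rewrite ≡ᵇ⇒≡ l' l (subst T (sym e) tt) = here refl
... | false with m
...   | here refl rewrite ≡ᵇ-refl l' = ⊥-elim (t≢f e)
  where t≢f : true ≡ false → ⊥
        t≢f ()
...   | there m' = there (kindAt∈ l xs m')

kindAt-unique : ∀ l k (xs : List Vertex) → (l , k) ∈ xs → occ l (map proj₁ xs) ≤ 1 → kindAt l xs ≡ k
kindAt-unique l k ((l' , k') ∷ xs) (here refl) h rewrite ≡ᵇ-refl l = refl
kindAt-unique l k ((l' , k') ∷ xs) (there m) h with l' ≡ᵇ l in e
... | true = ⊥-elim (<-irrefl refl (≤-trans (s≤s (occ-∈ l (map proj₁ xs) (∈-map⁺ proj₁ m))) h))
... | false = kindAt-unique l k xs m h

sum-map-+ : ∀ {A : Set} (f g : A → ℕ) xs → sum (map f xs) + sum (map g xs) ≡ sum (map (λ y → f y + g y) xs)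
sum-map-+ f g [] = refl
sum-map-+ f g (y ∷ xs) = trans (regroup (f y) (g y) (sum (map f xs)) (sum (map g xs))) (cong (f y + g y +_) (sum-map-+ f g xs))
  where
  regroup : ∀ a b c d → (a + c) + (b + d) ≡ (a + b) + (c + d)
  regroup = solve-∀

statistic-sum : ∀ N κ' t → Labelled N t → T (realises κ' t) → nInt t + nLevY t ≡ sum (map (λ l → weight (κ' l)) (oneTo N))
statistic-sum N κ' t hl hk = begin
  nInt t + nLevY t ≡⟨ cong₂ _+_ (nInt-vertices t) (nLevY-vertices t) ⟩
  _ ≡⟨ sum-map-+ _ _ (vertices t) ⟩
  sum (map (λ p → weight (proj₂ p)) (vertices t)) ≡⟨ sum-cong _ _ (vertices t) (λ y m → cong (weight) (sym (==K⇒≡ _ _ (T-all⁻ (agrees κ') (vertices t) hk m)))) ⟩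
  sum (map (λ p → weight (κ' (proj₁ p))) (vertices t)) ≡⟨ cong sum (map-∘ (vertices t)) ⟩
  sum (map (λ l → weight (κ' l)) (map proj₁ (vertices t))) ≡⟨ cong (λ z → sum (map (λ l → weight (κ' l)) z)) (sym (labels-vertices t)) ⟩
  sum (map (λ l → weight (κ' l)) (labels t)) ≡⟨ sum-↭ (map⁺ (λ l → weight (κ' l)) (Labelled⇒↭ N t hl)) ⟩
  _ ∎
  where open ≡-Reasoning

module Decompose (n x q k : ℕ) where
  open Assignment n x q
  open AssignmentSum n x q (weight) refl refl

  Γk ByWord : Set
  Γk = Σ Tree (λ t → T (inΓ n x q t) × (nInt t + nLevY t ≡ k + x))
  ByWord = Σ (Vec Letter n) (λ w → (nIY w ≡ k) × Trees N (κ w))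

  wordOf : Tree → Vec Letter n
  wordOf t = tabulate (λ i → kindLetter (kindAt (suc (q + x + toℕ i)) (vertices t)))

  rng : ∀ t → Labelled N t → ∀ {l k'} → (l , k') ∈ vertices t → Σ ℕ (λ j → l ≡ suc j × j < N)
  rng t hl {l} m = label-range N t hl (subst (l ∈_) (sym (labels-vertices t)) (∈-map⁺ proj₁ m))

  wordKind-wordOf : ∀ t i → (i<n : i < n) → wordKind (wordOf t) i ≡ letterKind (kindLetter (kindAt (suc (q + x + i)) (vertices t)))
  wordKind-wordOf t i i<n = trans (cong (wordKind (wordOf t)) (sym (FinP.toℕ-fromℕ< i<n)))
    (trans (wordKind-lookup (wordOf t) (fromℕ< i<n)) (cong letterKind (trans (lookup∘tabulate _ (fromℕ< i<n))
      (cong (λ z → kindLetter (kindAt (suc (q + x + z)) (vertices t))) (FinP.toℕ-fromℕ< i<n)))))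

  realises-wordOf : ∀ t → Labelled N t → T (allVerticesOK x q t) → T (realises (κ (wordOf t)) t)
  realises-wordOf t hl ha = T-all⁺ (agrees (κ (wordOf t))) (vertices t) λ { {l , k'} m → go l k' m }
    where
    ha' : T (all (kindAllowed x q) (vertices t))
    ha' = subst T (allVerticesOK-vertices x q t) ha
    go : ∀ l k' → (l , k') ∈ vertices t → T (κ (wordOf t) l ==K k')
    go l k' m with T-all⁻ (kindAllowed x q) (vertices t) ha' m | ≤-<-connex l q
    ... | allowed | inj₁ le = ≡⇒T==K (trans (κ-lo (wordOf t) l le) (sym (allowed-lo l k' le allowed)))
    ... | allowed | inj₂ lt1 with ≤-<-connex l (q + x)
    ...   | inj₁ le2 = ≡⇒T==K (trans (κ-mid (wordOf t) l lt1 le2) (sym (allowed-mid l k' lt1 le2 allowed)))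
    ...   | inj₂ lt2 with rng t hl m
    ...     | j , refl , j<N with upper-label n x q (suc j) lt2 j<N
    ...       | i<n , eqi = ≡⇒T==K (begin
      κ (wordOf t) (suc j)                                              ≡⟨ κ-hi (wordOf t) (suc j) lt2 ⟩
      wordKind (wordOf t) i                                             ≡⟨ wordKind-wordOf t i i<n ⟩
      letterKind (kindLetter (kindAt (suc (q + x + i)) (vertices t))) ≡⟨ cong (λ z → letterKind (kindLetter (kindAt z (vertices t)))) eqi ⟩
      letterKind (kindLetter (kindAt (suc j) (vertices t)))            ≡⟨ cong (λ z → letterKind (kindLetter z)) kindAt-k' ⟩
      letterKind (kindLetter k')                                        ≡⟨ letterKind-kindLetter k' (allowed-hi (suc j) k' lt2 allowed) ⟩
      k' ∎)
      where
      open ≡-Reasoning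
      i = suc j ∸ suc (q + x)
      kindAt-k' : kindAt (suc j) (vertices t) ≡ k'
      kindAt-k' = kindAt-unique (suc j) k' (vertices t) m (occ-labels≤1 N t hl (suc j))

  allVerticesOK-word : ∀ w t → Labelled N t → T (realises (κ w) t) → T (allVerticesOK x q t)
  allVerticesOK-word w t hl hk = subst T (sym (allVerticesOK-vertices x q t)) (T-all⁺ (kindAllowed x q) (vertices t) λ { {l , k'} m → go l k' m })
    where
    go : ∀ l k' → (l , k') ∈ vertices t → T (kindAllowed x q (l , k'))
    go l k' m with ==K⇒≡ _ _ (T-all⁻ (agrees (κ w)) (vertices t) hk m) | rng t hl m
    ... | refl | j , refl , j<N = allowed-κ w (suc j) j<N

  wordOf-unique : ∀ w t → Labelled N t → T (realises (κ w) t) → wordOf t ≡ w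
  wordOf-unique w t hl hk = trans (tabulate-cong pt) (tabulate∘lookup w)
    where
    pt : ∀ (i : Fin n) → kindLetter (kindAt (suc (q + x + toℕ i)) (vertices t)) ≡ lookup w i
    pt i = trans (cong kindLetter (sym e3)) (trans (cong kindLetter (trans e4 (wordKind-lookup w i))) (kindLetter-letterKind (lookup w i)))
      where
      l = suc (q + x + toℕ i)
      l≤N : q + x + toℕ i < N
      l≤N = subst (_≤ N) (+-suc (q + x) (toℕ i)) (subst₂ _≤_ (+-comm (suc (toℕ i)) (q + x)) (regroup n x q) (+-monoˡ-≤ (q + x) (FinP.toℕ<n i)))
        where
        regroup : ∀ n x q → n + (q + x) ≡ n + x + q
        regroup = solve-∀
      lm : l ∈ map proj₁ (vertices t)
      lm = subst (l ∈_) (labels-vertices t) (∈-resp-↭ (↭-sym (Labelled⇒↭ N t hl)) (∈oneTo⁺ l≤N))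
      e3 : κ w l ≡ kindAt l (vertices t)
      e3 = ==K⇒≡ _ _ (T-all⁻ (agrees (κ w)) (vertices t) hk (kindAt∈ l (vertices t) lm))
      e4 : κ w l ≡ wordKind w (toℕ i)
      e4 = trans (κ-hi w l (s≤s (m≤m+n (q + x) (toℕ i)))) (cong (wordKind w) (m+n∸m≡n (q + x) (toℕ i)))

  statistic-word : ∀ w t → Labelled N t → T (realises (κ w) t) → nInt t + nLevY t ≡ x + nIY w
  statistic-word w t hl hk = trans (statistic-sum N (κ w) t hl hk) (trans (sum-assignment w) (cong (x +_) (wordSum-weight w)))

  toWord : Γk → ByWord
  toWord (t , hΓ , hs) = wordOf t , +-cancelˡ-≡ x _ _ (trans (sym (statistic-word (wordOf t) t hl hk)) (trans hs (+-comm k x))) , (t , hl , hk)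
    where
    hl = ∧-l hΓ
    hk = realises-wordOf t hl (∧-r {isLabelling N (labels t)} hΓ)

  fromWord : ByWord → Γk
  fromWord (w , e , (t , hl , hk)) = t , from (T-∧ {isLabelling N (labels t)}) (hl , allVerticesOK-word w t hl hk) , trans (statistic-word w t hl hk) (trans (cong (x +_) e) (+-comm x k))

  ByWord-≡ : ∀ {w1 w2 : Vec Letter n} (p : w1 ≡ w2) e1 e2 (c1 : Trees N (κ w1)) (c2 : Trees N (κ w2)) → proj₁ c1 ≡ proj₁ c2 →
    _≡_ {A = ByWord} (w1 , e1 , c1) (w2 , e2 , c2)
  ByWord-≡ refl e1 e2 c1 c2 q' = cong₂ (λ a b → (_ , a , b)) (≡-irrelevant e1 e2) (Trees-≡ c1 c2 q')

  Γk↔ByWord : Γk ↔ ByWord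
  Γk↔ByWord = mk↔ₛ′ toWord fromWord fb bf
    where
    fb : ∀ r → toWord (fromWord r) ≡ r
    fb (w , e , (t , hl , hk)) = ByWord-≡ (wordOf-unique w t hl hk) _ _ _ _ refl
    bf : ∀ g → fromWord (toWord g) ≡ g
    bf (t , hΓ , hs) = cong (t ,_) (cong₂ _,_ (T-irrelevant {inΓ n x q t} _ _) (≡-irrelevant _ _))

sumWords : ∀ {n} → (Vec Letter n → ℕ) → ℕ
sumWords {zero} f = f []
sumWords {suc n} f = sumWords (λ w → f (tI ∷ w)) + (sumWords (λ w → f (tY ∷ w)) + sumWords (λ w → f (tN ∷ w)))

Σ-Word↔sum : ∀ {n} {B : Vec Letter n → Set} (f : Vec Letter n → ℕ) → (∀ w → B w ↔ Fin (f w)) → Σ (Vec Letter n) B ↔ Fin (sumWords f)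
Σ-Word↔sum {zero} {B} f e = ↔-trans (mk↔ₛ′ (λ { ([] , b) → b }) (λ b → [] , b) (λ _ → refl) (λ { ([] , b) → refl })) (e [])
Σ-Word↔sum {suc n} {B} f e = ↔-trans split (↔-trans (Σ-Word↔sum _ (λ w → e (tI ∷ w)) ⊎-↔ (Σ-Word↔sum _ (λ w → e (tY ∷ w)) ⊎-↔ Σ-Word↔sum _ (λ w → e (tN ∷ w))))
  (↔-trans (↔-refl ⊎-↔ ↔-sym +↔⊎) (↔-sym +↔⊎)))
  where
  split : Σ (Vec Letter (suc n)) B ↔ (Σ (Vec Letter n) (λ w → B (tI ∷ w)) ⊎ (Σ (Vec Letter n) (λ w → B (tY ∷ w)) ⊎ Σ (Vec Letter n) (λ w → B (tN ∷ w))))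
  split = mk↔ₛ′ to' from' tf ft
    where
    to' : Σ (Vec Letter (suc n)) B → _
    to' (tI ∷ w , b) = inj₁ (w , b)
    to' (tY ∷ w , b) = inj₂ (inj₁ (w , b))
    to' (tN ∷ w , b) = inj₂ (inj₂ (w , b))
    from' : _ → Σ (Vec Letter (suc n)) B
    from' (inj₁ (w , b)) = tI ∷ w , b
    from' (inj₂ (inj₁ (w , b))) = tY ∷ w , b
    from' (inj₂ (inj₂ (w , b))) = tN ∷ w , b
    tf : ∀ y → to' (from' y) ≡ y
    tf (inj₁ _) = refl
    tf (inj₂ (inj₁ _)) = refl
    tf (inj₂ (inj₂ _)) = refl
    ft : ∀ y → from' (to' y) ≡ y
    ft (tI ∷ w , b) = refl
    ft (tY ∷ w , b) = refl
    ft (tN ∷ w , b) = refl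

-- Γ_{n,x,q} restricted to the statistic k + x has Σ_w [nIY w = k] L N (x + nI w)
-- elements: by the decomposition by words and the main counting lemma, as κ_w
-- declares x + nI w labels internal.
module Count (n x q k : ℕ) where
  open Assignment n x q
  open Decompose n x q k

  countFor : Vec Letter n → ℕ
  countFor w = if nIY w ≡ᵇ k then L N (x + nI w) else 0

  nInternal-word : ∀ w → nInternal N (κ w) ≡ x + nI w
  nInternal-word w = trans (AssignmentSum.sum-assignment n x q isInternal refl refl w) (cong (x +_) (wordSum-isInternal w))

  countFor↔ : ∀ w → ((nIY w ≡ k) × Trees N (κ w)) ↔ Fin (countFor w)
  countFor↔ w with nIY w ≡ᵇ k in e
  ... | true = ↔-trans (mk↔ₛ′ proj₂ (λ c → ≡ᵇ-true e , c) (λ _ → refl) (λ (p , c) → cong (_, c) (≡-irrelevant _ _)))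
               (↔-trans (count-Trees N (κ w) (NoColouredInternal-word w)) (Fin-cast (cong (L N) (nInternal-word w))))
  ... | false = empty↔ (λ (p , _) → contradiction (trans (sym e) (trans (cong (_≡ᵇ k) p) (≡ᵇ-refl k))) λ ())

  Γk↔sum : Γk ↔ Fin (sumWords countFor)
  Γk↔sum = ↔-trans Γk↔ByWord (Σ-Word↔sum countFor countFor↔)

sumWords-cong : ∀ {n} (f g : Vec Letter n → ℕ) → (∀ w → f w ≡ g w) → sumWords f ≡ sumWords g
sumWords-cong {zero} f g h = h []
sumWords-cong {suc n} f g h = cong₂ _+_ (sumWords-cong _ _ (λ w → h (tI ∷ w))) (cong₂ _+_ (sumWords-cong _ _ (λ w → h (tY ∷ w))) (sumWords-cong _ _ (λ w → h (tN ∷ w))))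

sumWords-0 : ∀ {n} → sumWords {n} (λ _ → 0) ≡ 0
sumWords-0 {zero} = refl
sumWords-0 {suc n} rewrite sumWords-0 {n} = refl

sumWords-* : ∀ {n} c (f : Vec Letter n → ℕ) → sumWords (λ w → c * f w) ≡ c * sumWords f
sumWords-* {zero} c f = refl
sumWords-* {suc n} c f rewrite sumWords-* c (λ w → f (tI ∷ w)) | sumWords-* c (λ w → f (tY ∷ w)) | sumWords-* c (λ w → f (tN ∷ w)) =
  sym (trans (*-distribˡ-+ c _ _) (cong (λ z → c * sumWords (λ w → f (tI ∷ w)) + z) (*-distribˡ-+ c _ _)))

-- Splitting off the first letter: I raises both a and nIY, Y raises nIY, N
-- raises neither, and Pascal's rule closes the recursion.
wordTerm : ℕ → ℕ → ℕ → ∀ {n} → Vec Letter n → ℕ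
wordTerm m k a w = if nIY w ≡ᵇ k then chooseP m (a + nI w) else 0

sumWords-wordTerm : ∀ m n k a → sumWords {n} (wordTerm m k a) ≡ choose n k * chooseP (m + k) (a + k)
sumWords-wordTerm m zero zero a rewrite +-identityʳ m | +-identityʳ a = sym (+-identityʳ _)
sumWords-wordTerm m zero (suc k) a = refl
sumWords-wordTerm m (suc n) zero a rewrite sumWords-0 {n} | sumWords-wordTerm m n zero a = refl
sumWords-wordTerm m (suc n) (suc k) a = begin
  sumWords {n} (λ w → wordTerm m (suc k) a (tI ∷ w)) + (sumWords {n} (λ w → wordTerm m (suc k) a (tY ∷ w)) + sumWords {n} (λ w → wordTerm m (suc k) a (tN ∷ w)))
    ≡⟨ cong₂ _+_ (trans (sumWords-cong {n} _ _ (λ w → first-letter-I w)) (sumWords-wordTerm m n k (suc a))) (cong₂ _+_ (sumWords-wordTerm m n k a) (sumWords-wordTerm m n (suc k) a)) ⟩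
  choose n k * chooseP (m + k) (suc a + k) + (choose n k * chooseP (m + k) (a + k) + choose n (suc k) * chooseP (m + suc k) (a + suc k))
    ≡⟨ cong (λ z → choose n k * chooseP (m + k) (suc a + k) + (choose n k * chooseP (m + k) (a + k) + choose n (suc k) * z)) (trans (cong₂ chooseP (+-suc m k) (+-suc a k)) (chooseP-pascal (m + k) (a + k))) ⟩
  choose n k * chooseP (m + k) (suc (a + k)) + (choose n k * chooseP (m + k) (a + k) + choose n (suc k) * (chooseP (m + k) (suc (a + k)) + chooseP (m + k) (a + k)))
    ≡⟨ regroup (choose n k) (choose n (suc k)) (chooseP (m + k) (suc (a + k))) (chooseP (m + k) (a + k)) ⟩
  (choose n k + choose n (suc k)) * (chooseP (m + k) (suc (a + k)) + chooseP (m + k) (a + k))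
    ≡⟨ cong ((choose n k + choose n (suc k)) *_) (sym (trans (cong₂ chooseP (+-suc m k) (+-suc a k)) (chooseP-pascal (m + k) (a + k)))) ⟩
  (choose n k + choose n (suc k)) * chooseP (m + suc k) (a + suc k) ∎
  where
  open ≡-Reasoning
  first-letter-I : ∀ (w : Vec Letter n) → wordTerm m (suc k) a (tI ∷ w) ≡ wordTerm m k (suc a) w
  first-letter-I w with nIY w ≡ᵇ k
  ... | true = cong (chooseP m) (+-suc a (nI w))
  ... | false = refl
  regroup : ∀ p q e f → p * e + (p * f + q * (e + f)) ≡ (p + q) * (e + f)
  regroup = solve-∀

open import Data.Integer using (ℤ; +_; _-_; _/ℕ_) renaming (_*_ to _*ℤ_)
import Data.Integer.Properties as ℤP

falling-choose : ∀ a b → falling (+ a) b ≡ + (choose a b * b !)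
falling-choose a zero = refl
falling-choose a (suc b) with <-≤-connex a b
... | inj₁ a<b rewrite falling-choose a b | choose-< a b a<b | choose-< a (suc b) (≤-trans a<b (n≤1+n b)) = refl
... | inj₂ b≤a rewrite falling-choose a b = begin
  + (choose a b * b !) *ℤ (+ a - + b) ≡⟨ cong (λ z → + (choose a b * b !) *ℤ z) (trans (ℤP.m-n≡m⊖n a b) (ℤP.⊖-≥ b≤a)) ⟩
  + (choose a b * b !) *ℤ + (a ∸ b) ≡⟨ sym (ℤP.pos-* (choose a b * b !) (a ∸ b)) ⟩
  + (choose a b * b ! * (a ∸ b)) ≡⟨ cong +_ absorb-step ⟩
  + (choose a (suc b) * suc b !) ∎
  where
  open ≡-Reasoning
  absorb-step : choose a b * b ! * (a ∸ b) ≡ choose a (suc b) * suc b !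
  absorb-step = begin
    choose a b * b ! * (a ∸ b) ≡⟨ regroup₁ (choose a b) (b !) (a ∸ b) ⟩
    ((a ∸ b) * choose a b) * b ! ≡⟨ cong (_* b !) (sym (choose-absorb a b)) ⟩
    (suc b * choose a (suc b)) * b ! ≡⟨ regroup₂ (suc b) (choose a (suc b)) (b !) ⟩
    choose a (suc b) * (suc b * b !) ∎
    where
    regroup₁ : ∀ x y z → x * y * z ≡ (z * x) * y
    regroup₁ = solve-∀
    regroup₂ : ∀ x y z → (x * y) * z ≡ y * (x * z)
    regroup₂ = solve-∀

binom-ℕ : ∀ a b → binom (+ a) (+ b) ≡ + choose a b
binom-ℕ a b = trans (cong (λ z → _/ℕ_ z (b !) {{b !≢0}}) (falling-choose a b)) (cong +_ (m*n/n≡m (choose a b) (b !) {{b !≢0}}))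

-- Evaluation of the sum.  With N = n + x + q = m + 2, the count is
--   (m+1)! · C(n,k) · C(m+k, x+k-1),
-- and C(m+k, x+k-1) = C(m+k, n+q-1) because (x+k-1) + (n+q-1) = m+k.

rhs : ℕ → ℕ → ℕ → ℕ → ℤ
rhs n x q k = (binom (+ n) (+ k) *ℤ binom (+ (k + n + x + q) - + 2) (+ (n + q) - + 1)) *ℤ (+ ((n + x + q ∸ 1) !))

binom-chooseP : ∀ M p → binom (+ (suc (suc M)) - + 2) (+ p - + 1) ≡ + chooseP M p
binom-chooseP M zero = refl
binom-chooseP M (suc r) = binom-ℕ M r

chooseP-sym : ∀ M a b → a + b ≡ suc (suc M) → chooseP M a ≡ chooseP M b
chooseP-sym M zero .(suc (suc M)) refl = sym (choose-< M (suc M) ≤-refl)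
chooseP-sym M (suc a) zero e rewrite suc-injective (trans (sym (+-identityʳ (suc a))) e) = choose-< M (suc M) ≤-refl
chooseP-sym M (suc a) (suc b) e = subst (λ z → choose z a ≡ choose z b) a+b≡M (choose-sym a b)
  where
  a+b≡M : a + b ≡ M
  a+b≡M = suc-injective (suc-injective (trans (cong suc (sym (+-suc a b))) e))

module LargeCase (n x q k m : ℕ) (eN : n + x + q ≡ suc (suc m)) where
  open Count n x q k

  countFor-closed : ∀ w → countFor w ≡ suc m ! * wordTerm m k x w
  countFor-closed w with nIY w ≡ᵇ k
  ... | true = trans (cong (λ z → L z (x + nI w)) eN) (L-closed-form m (x + nI w))
  ... | false = sym (*-zeroʳ (suc m !))

  sumWords-countFor : sumWords countFor ≡ suc m ! * (choose n k * chooseP (m + k) (x + k))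
  sumWords-countFor = begin
    sumWords countFor                                  ≡⟨ sumWords-cong _ _ countFor-closed ⟩
    sumWords {n} (λ w → suc m ! * wordTerm m k x w)    ≡⟨ sumWords-* {n} (suc m !) (wordTerm m k x) ⟩
    suc m ! * sumWords {n} (wordTerm m k x)            ≡⟨ cong (suc m ! *_) (sumWords-wordTerm m n k x) ⟩
    suc m ! * (choose n k * chooseP (m + k) (x + k))   ∎
    where open ≡-Reasoning

  second-binomial : binom (+ (k + n + x + q) - + 2) (+ (n + q) - + 1) ≡ + chooseP (m + k) (x + k)
  second-binomial = begin
    binom (+ (k + n + x + q) - + 2) (+ (n + q) - + 1)       ≡⟨ cong (λ z → binom (+ z - + 2) (+ (n + q) - + 1)) top-index ⟩
    binom (+ (suc (suc (m + k))) - + 2) (+ (n + q) - + 1)   ≡⟨ binom-chooseP (m + k) (n + q) ⟩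
    + chooseP (m + k) (n + q)                               ≡⟨ cong +_ (chooseP-sym (m + k) (n + q) (x + k) indices) ⟩
    + chooseP (m + k) (x + k)                               ∎
    where
    open ≡-Reasoning
    regroup₁ : ∀ k n x q → k + n + x + q ≡ (n + x + q) + k
    regroup₁ = solve-∀
    regroup₂ : ∀ n x q k → (n + q) + (x + k) ≡ (n + x + q) + k
    regroup₂ = solve-∀
    top-index : k + n + x + q ≡ suc (suc (m + k))
    top-index = trans (regroup₁ k n x q) (cong (_+ k) eN)
    indices : (n + q) + (x + k) ≡ suc (suc (m + k))
    indices = trans (regroup₂ n x q k) (cong (_+ k) eN)

  formula : + sumWords countFor ≡ rhs n x q k
  formula = begin
    + sumWords countFor                                  ≡⟨ cong +_ (trans sumWords-countFor (*-comm F (B * C))) ⟩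
    + (B * C * F)                                        ≡⟨ trans (ℤP.pos-* (B * C) F) (cong (_*ℤ + F) (ℤP.pos-* B C)) ⟩
    (+ B *ℤ + C) *ℤ + F                                  ≡⟨ cong₂ (λ b c → (b *ℤ c) *ℤ + F) (sym (binom-ℕ n k)) (sym second-binomial) ⟩
    (binom (+ n) (+ k) *ℤ binom (+ (k + n + x + q) - + 2) (+ (n + q) - + 1)) *ℤ + F
                                                         ≡⟨ cong (λ z → (binom (+ n) (+ k) *ℤ binom (+ (k + n + x + q) - + 2) (+ (n + q) - + 1)) *ℤ + (z !)) (sym (cong (_∸ 1) eN)) ⟩
    rhs n x q k                                          ∎
    where
    open ≡-Reasoning
    F = suc m !
    B = choose n k
    C = chooseP (m + k) (x + k)

single-vertex : ∀ n x q k → n + x + q ≡ 1 → + sumWords (Count.countFor n x q k) ≡ rhs n x q k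
single-vertex zero zero zero k ()
single-vertex zero zero (suc zero) zero refl = refl
single-vertex zero zero (suc zero) (suc k) refl rewrite binom-ℕ 0 (suc k) = refl
single-vertex zero zero (suc (suc q)) k ()
single-vertex zero (suc zero) zero zero refl = refl
single-vertex zero (suc zero) zero (suc k) refl = sym (cong (_*ℤ + 1) (ℤP.*-zeroʳ (binom (+ 0) (+ suc k))))
single-vertex zero (suc zero) (suc q) k ()
single-vertex zero (suc (suc x)) q k ()
single-vertex (suc zero) zero zero zero refl = refl
single-vertex (suc zero) zero zero (suc zero) refl = refl
single-vertex (suc zero) zero zero (suc (suc k)) refl rewrite binom-ℕ 1 (suc (suc k)) = refl
single-vertex (suc zero) zero (suc q) k ()
single-vertex (suc zero) (suc x) q k ()
single-vertex (suc (suc n)) x q k ()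

count-formula : ∀ n x q k → 1 ≤ n + x + q → + sumWords (Count.countFor n x q k) ≡ rhs n x q k
count-formula n x q k h = by-size (n + x + q) refl h
  where
  by-size : ∀ N → n + x + q ≡ N → 1 ≤ N → + sumWords (Count.countFor n x q k) ≡ rhs n x q k
  by-size (suc zero) e _ = single-vertex n x q k e
  by-size (suc (suc m)) e _ = LargeCase.formula n x q k m e

proposition2p2 : (n x q k : ℕ) → 1 ≤ n + x + q →
    Σ ℕ (λ c →
    (Σ Tree (λ t → T (inΓ n x q t) × (nInt t + nLevY t ≡ k + x)) ↔ Fin c)
    × ((+ c) ≡ (binom (+ n) (+ k)
    *ℤ binom (+ (k + n + x + q) - + 2) (+ (n + q) - + 1))
    *ℤ (+ ((n + x + q ∸ 1) !))))
proposition2p2 n x q k h = sumWords (Count.countFor n x q k) , Count.Γk↔sum n x q k , count-formula n x q k h
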